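{- Over the rational function field $\mathbb{Q}(m,n)$, let $E$ be the elliptic curve $W^2=U^3+A U^2+B U+C$ with $A=1-2n^2+(1+n)^2m^2$, $B=-n^2(1+n)\big((1-n)+2(1+n)m^2\big)$, $C=n^4(1+n)^2m^2$. Then the point $P_1=(U,W)=(n^2-1,\,m(1+n))\in E(\mathbb{Q}(m,n))$ has infinite order. -}

module Defs where

open import Data.Bool using (Bool; true; false; _∧_)
open import Data.List using (List; []; _∷_; map)
open import Data.Nat using (ℕ; zero; suc)
open import Data.Integer as ℤ using (ℤ; +_; -[1+_])
open import Data.Product using (_×_; _,_; proj₁; proj₂)

record DRing : Set₁ where
  field
    Carrier : Set
    zeroR   : Carrier
    oneR    : Carrier
    addR    : Carrier → Carrier → Carrier
    mulR    : Carrier → Carrier → Carrier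
    negR    : Carrier → Carrier
    isZeroR : Carrier → Bool

isZeroℤ : ℤ → Bool
isZeroℤ (+ zero)    = true
isZeroℤ (+ (suc _)) = false
isZeroℤ -[1+ _ ]    = false

ℤ-DRing : DRing
ℤ-DRing = record
  { Carrier = ℤ ; zeroR = + 0 ; oneR = + 1 ; addR = ℤ._+_ ; mulR = ℤ._*_
  ; negR = ℤ.-_ ; isZeroR = isZeroℤ }

-- Univariate polynomial ring R[X] as coefficient lists (lowest degree
-- first, trailing zeros allowed; a polynomial is zero iff all its
-- coefficients are zero).

module PolyOps (R : DRing) where
  open DRing R

  addP : List Carrier → List Carrier → List Carrier
  addP []       q        = q
  addP (a ∷ p)  []       = a ∷ p
  addP (a ∷ p)  (b ∷ q)  = addR a b ∷ addP p q

  mulP : List Carrier → List Carrier → List Carrier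
  mulP []      q = []
  mulP (a ∷ p) q = addP (map (mulR a) q) (zeroR ∷ mulP p q)

  allZero : List Carrier → Bool
  allZero []      = true
  allZero (a ∷ p) = isZeroR a ∧ allZero p

Poly : DRing → DRing
Poly R = record
  { Carrier = List Carrier ; zeroR = [] ; oneR = oneR ∷ []
  ; addR = addP ; mulR = mulP ; negR = map negR ; isZeroR = allZero }
  where open DRing R
        open PolyOps R

varX : (R : DRing) → DRing.Carrier (Poly R)
varX R = DRing.zeroR R ∷ DRing.oneR R ∷ []

constP : (R : DRing) → DRing.Carrier R → DRing.Carrier (Poly R)
constP R c = c ∷ []

-- ℤ[m,n] := (ℤ[m])[n]
ℤmn : DRing
ℤmn = Poly (Poly ℤ-DRing)

record DField : Set₁ where
  field
    ring : DRing
    invF : DRing.Carrier ring → DRing.Carrier ring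
  open DRing ring public

-- Fraction field of an integral domain R: pairs (numerator , denominator)
-- with nonzero denominator (an invariant preserved by all operations as
-- long as one never inverts zero), (a,b) = (c,d) iff a*d - c*b = 0.
Frac : DRing → DField
Frac R = record
  { ring = record
      { Carrier = Carrier × Carrier
      ; zeroR   = zeroR , oneR
      ; oneR    = oneR , oneR
      ; addR    = λ x y → addR (mulR (proj₁ x) (proj₂ y)) (mulR (proj₁ y) (proj₂ x))
                          , mulR (proj₂ x) (proj₂ y)
      ; mulR    = λ x y → mulR (proj₁ x) (proj₁ y) , mulR (proj₂ x) (proj₂ y)
      ; negR    = λ x → negR (proj₁ x) , proj₂ x
      ; isZeroR = λ x → isZeroR (proj₁ x) }
  ; invF = λ x → proj₂ x , proj₁ x }
  where open DRing R

ℚmn : DField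
ℚmn = Frac ℤmn

module _ where
  open DField ℚmn

  embed : DRing.Carrier ℤmn → Carrier
  embed p = p , DRing.oneR ℤmn

  m : Carrier
  m = embed (constP (Poly ℤ-DRing) (varX ℤ-DRing))

  n : Carrier
  n = embed (varX (Poly ℤ-DRing))

  intK : ℤ → Carrier
  intK z = embed (constP (Poly ℤ-DRing) (constP ℤ-DRing z))

module Curve (K : DField) where
  open DField K

  data Point : Set where
    O   : Point
    aff : Carrier → Carrier → Point

  _-K_ : Carrier → Carrier → Carrier
  x -K y = addR x (negR y)

  eqK : Carrier → Carrier → Bool
  eqK x y = isZeroR (x -K y)

  two three : Carrier
  two   = addR oneR oneR
  three = addR two oneR

  sq : Carrier → Carrier
  sq x = mulR x x

  OnCurve : (a b c : Carrier) → Point → Set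
  OnCurve a b c O         = Data.Bool.T true
  OnCurve a b c (aff x y) =
    Data.Bool.T (eqK (sq y) (addR (addR (addR (mulR x (sq x)) (mulR a (sq x))) (mulR b x)) c))

  third : (a l x1 y1 x2 : Carrier) → Point
  third a l x1 y1 x2 =
    let x3 = ((sq l -K a) -K x1) -K x2
    in aff x3 (mulR l (x1 -K x3) -K y1)

  add : (a b c : Carrier) → Point → Point → Point
  add a b c O q = q
  add a b c (aff x1 y1) O = aff x1 y1
  add a b c (aff x1 y1) (aff x2 y2) with eqK x1 x2
  ... | false = third a (mulR (y2 -K y1) (invF (x2 -K x1))) x1 y1 x2
  ... | true with isZeroR (addR y1 y2)
  ...   | true  = O
  ...   | false =
          third a
            (mulR (addR (addR (mulR three (sq x1)) (mulR (mulR two a) x1)) b)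
                  (invF (mulR two y1)))
            x1 y1 x2

  smul : (a b c : Carrier) → ℕ → Point → Point
  smul a b c zero    p = O
  smul a b c (suc k) p = add a b c p (smul a b c k p)

open DField ℚmn
open Curve ℚmn

coefA coefB coefC : Carrier
coefA = addR (oneR -K mulR two (sq n)) (mulR (sq (addR oneR n)) (sq m))
coefB = negR (mulR (mulR (sq n) (addR oneR n))
                   (addR (oneR -K n) (mulR (mulR two (addR oneR n)) (sq m))))
coefC = mulR (mulR (sq (sq n)) (sq (addR oneR n))) (sq m)

P₁ : Point
P₁ = aff (sq n -K oneR) (mulR m (addR oneR n))

{-# OPTIONS --safe #-}
-- Fix k and a prime p > k + 4, and specialise m ↦ p, n ↦ 2.  The curve becomes
-- y² = x³ + (9p² − 7) x² + (12 − 72p²) x + 144p² with P₁ ↦ (3, 3p); modulo p it is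
-- y² = x (x − 3) (x − 4), on which P₁ reduces to the 2-torsion point (3, 0).  Following the chord
-- construction p-adically, the odd multiples j P₁ (j < p − 1) reduce to (3, 0) and the even ones to O,
-- with j visible modulo p in their leading coefficients.  This keeps every chord through P₁
-- non-vertical, so each j P₁ specialises to an affine point and therefore is not O over ℚ(m,n).
module Submission where

open import Defs
open import Data.Nat using (ℕ; zero; suc)
open import Data.Product using (_×_; Σ; _,_; proj₁; proj₂)
open import Relation.Binary.PropositionalEquality using (_≢_)

import Data.Nat as ℕ
import Data.Nat.Properties as ℕP
import Data.Nat.Literals as ℕ-Literals
open import Data.Nat.Divisibility as ℕDiv using (m∣m*n; ∣-trans; m≤n⇒m!∣n!; ∣1⇒≡1; ∣m+n∣m⇒∣n)
open import Data.Nat.Primality using (Prime; euclidsLemma; prime⇒nonTrivial)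
open import Data.Nat.Primality.Factorisation using (factorise; PrimeFactorisation)
open import Data.Nat.ListAction using (product)
open import Data.Integer as ℤ using (ℤ; +_)
import Data.Integer.Properties as ℤP
import Data.Integer.Divisibility.Signed as ℤDiv
open import Data.Rational as ℚ using (ℚ; 0ℚ; 1ℚ; _+_; _*_; -_; _-_)
import Data.Rational.Properties as ℚP
import Data.Rational.Literals as ℚ-Literals
import Data.Rational.Unnormalised as ℚᵘ
import Data.Rational.Unnormalised.Properties as ℚᵘP
open import Data.Bool using (true; false)
open import Data.Empty using (⊥; ⊥-elim)
open import Data.List using (List; []; _∷_; map)
open import Data.List.Relation.Unary.All as All using (All)
open import Data.Sum using (_⊎_; inj₁; inj₂)
open import Data.Unit.Base using (tt)
open import Function using (_∘_)
open import Level using (0ℓ)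
open import Relation.Nullary using (¬_; yes; no)
open import Relation.Nullary.Decidable using (dec⇒maybe)
open import Relation.Binary.PropositionalEquality
  using (_≡_; refl; sym; trans; cong; cong₂; subst; module ≡-Reasoning)
open import Agda.Builtin.FromNat using (Number; fromNat)
open import Tactic.RingSolver using (solve)
import Tactic.RingSolver.Core.AlmostCommutativeRing as ACR
open import Algebra.Properties.Group ℚP.+-0-group using (x∙y⁻¹≈ε⇒x≈y; x≈y⇒x∙y⁻¹≈ε)

instance
  ℕ-number : Number ℕ
  ℕ-number = ℕ-Literals.number

  ℚ-number : Number ℚ
  ℚ-number = ℚ-Literals.number

ℚ-ring : ACR.AlmostCommutativeRing 0ℓ 0ℓ
ℚ-ring = ACR.fromCommutativeRing ℚP.+-*-commutativeRing (λ q → dec⇒maybe (0ℚ ℚP.≟ q))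

opaque
  ι : ℤ → ℚ
  ι z = ℚ.fromℚᵘ (ℚᵘ.mkℚᵘ z 0)

opaque
  unfolding ι

  ι-lit : ∀ k → ι (+ k) ≡ + k ℚ./ 1
  ι-lit k = refl

  toℚᵘ-ι : ∀ z → ℚ.toℚᵘ (ι z) ℚᵘ.≃ ℚᵘ.mkℚᵘ z 0
  toℚᵘ-ι z = ℚP.toℚᵘ-fromℚᵘ (ℚᵘ.mkℚᵘ z 0)

  ι-+ : ∀ a b → ι (a ℤ.+ b) ≡ ι a + ι b
  ι-+ a b = ℚP.toℚᵘ-injective (begin
    ℚ.toℚᵘ (ι (a ℤ.+ b))                ≈⟨ toℚᵘ-ι (a ℤ.+ b) ⟩
    ℚᵘ.mkℚᵘ (a ℤ.+ b) 0                 ≈⟨ ℚᵘ.*≡* denominators-one ⟩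
    ℚᵘ.mkℚᵘ a 0 ℚᵘ.+ ℚᵘ.mkℚᵘ b 0        ≈⟨ ℚᵘP.+-cong (toℚᵘ-ι a) (toℚᵘ-ι b) ⟨
    ℚ.toℚᵘ (ι a) ℚᵘ.+ ℚ.toℚᵘ (ι b)      ≈⟨ ℚP.toℚᵘ-homo-+ (ι a) (ι b) ⟨
    ℚ.toℚᵘ (ι a + ι b)                  ∎)
    where
    open ℚᵘP.≃-Reasoning
    denominators-one : (a ℤ.+ b) ℤ.* (+ 1 ℤ.* + 1) ≡ (a ℤ.* + 1 ℤ.+ b ℤ.* + 1) ℤ.* + 1
    denominators-one rewrite ℤP.*-identityʳ a | ℤP.*-identityʳ b | ℤP.*-identityʳ (a ℤ.+ b) = refl

  ι-* : ∀ a b → ι (a ℤ.* b) ≡ ι a * ι b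
  ι-* a b = ℚP.toℚᵘ-injective (begin
    ℚ.toℚᵘ (ι (a ℤ.* b))                ≈⟨ toℚᵘ-ι (a ℤ.* b) ⟩
    ℚᵘ.mkℚᵘ (a ℤ.* b) 0                 ≈⟨ ℚᵘ.*≡* refl ⟩
    ℚᵘ.mkℚᵘ a 0 ℚᵘ.* ℚᵘ.mkℚᵘ b 0        ≈⟨ ℚᵘP.*-cong (toℚᵘ-ι a) (toℚᵘ-ι b) ⟨
    ℚ.toℚᵘ (ι a) ℚᵘ.* ℚ.toℚᵘ (ι b)      ≈⟨ ℚP.toℚᵘ-homo-* (ι a) (ι b) ⟨
    ℚ.toℚᵘ (ι a * ι b)                  ∎)
    where open ℚᵘP.≃-Reasoning

  ι-neg : ∀ a → ι (ℤ.- a) ≡ - ι a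
  ι-neg a = ℚP.toℚᵘ-injective (begin
    ℚ.toℚᵘ (ι (ℤ.- a))                  ≈⟨ toℚᵘ-ι (ℤ.- a) ⟩
    ℚᵘ.mkℚᵘ (ℤ.- a) 0                   ≈⟨ ℚᵘ.*≡* refl ⟩
    ℚᵘ.- ℚᵘ.mkℚᵘ a 0                    ≈⟨ ℚᵘP.-‿cong (toℚᵘ-ι a) ⟨
    ℚᵘ.- ℚ.toℚᵘ (ι a)                   ≈⟨ ℚP.toℚᵘ-homo‿- (ι a) ⟨
    ℚ.toℚᵘ (- ι a)                      ∎)
    where open ℚᵘP.≃-Reasoning

  ι-injective : ∀ {a b} → ι a ≡ ι b → a ≡ b
  ι-injective {a} {b} e
    with ℚᵘP.≃-trans (ℚᵘP.≃-sym (toℚᵘ-ι a)) (ℚᵘP.≃-trans (ℚP.toℚᵘ-cong e) (toℚᵘ-ι b))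
  ... | ℚᵘ.*≡* a*1≡b*1 = trans (sym (ℤP.*-identityʳ a)) (trans a*1≡b*1 (ℤP.*-identityʳ b))

ι-suc : ∀ j → ι (+ suc j) ≡ ι (+ j) + 1
ι-suc j = trans (ι-+ (+ 1) (+ j)) (trans (cong (_+ ι (+ j)) (ι-lit 1)) (ℚP.+-comm 1ℚ (ι (+ j))))

x-y≡0⇒x≡y : ∀ {x y} → x - y ≡ 0ℚ → x ≡ y
x-y≡0⇒x≡y {x} {y} = x∙y⁻¹≈ε⇒x≈y x y

x≡y⇒x-y≡0 : ∀ {x y} → x ≡ y → x - y ≡ 0ℚ
x≡y⇒x-y≡0 = x≈y⇒x∙y⁻¹≈ε

x*y≡0⇒x≡0 : ∀ {x y} → y ≢ 0ℚ → x * y ≡ 0ℚ → x ≡ 0ℚ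
x*y≡0⇒x≡0 {x} {y} y≢0 x*y≡0 = begin
  x                ≡⟨ ℚP.*-identityʳ x ⟨
  x * 1ℚ           ≡⟨ cong (x *_) (ℚP.*-inverseʳ y) ⟨
  x * (y * ℚ.1/ y) ≡⟨ ℚP.*-assoc x y (ℚ.1/ y) ⟨
  x * y * ℚ.1/ y   ≡⟨ cong (_* ℚ.1/ y) x*y≡0 ⟩
  0ℚ * ℚ.1/ y      ≡⟨ ℚP.*-zeroˡ (ℚ.1/ y) ⟩
  0ℚ               ∎
  where
  open ≡-Reasoning
  instance _ = ℚ.≢-nonZero y≢0

x*y≡0⇒y≡0 : ∀ {x y} → x ≢ 0ℚ → x * y ≡ 0ℚ → y ≡ 0ℚ
x*y≡0⇒y≡0 {x} {y} x≢0 x*y≡0 = x*y≡0⇒x≡0 x≢0 (trans (ℚP.*-comm y x) x*y≡0)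

*-≢0 : ∀ {x y} → x ≢ 0ℚ → y ≢ 0ℚ → x * y ≢ 0ℚ
*-≢0 x≢0 y≢0 x*y≡0 = x≢0 (x*y≡0⇒x≡0 y≢0 x*y≡0)

*-cancelˡ-≢0 : ∀ {c a b} → c ≢ 0ℚ → c * a ≡ c * b → a ≡ b
*-cancelˡ-≢0 {c} {a} {b} c≢0 ca≡cb = x-y≡0⇒x≡y (x*y≡0⇒y≡0 c≢0 (begin
  c * (a - b)      ≡⟨ ℚP.*-distribˡ-+ c a (- b) ⟩
  c * a + c * - b  ≡⟨ cong₂ _+_ ca≡cb (sym (ℚP.neg-distribʳ-* c b)) ⟩
  c * b - c * b    ≡⟨ ℚP.+-inverseʳ (c * b) ⟩
  0ℚ               ∎))
  where open ≡-Reasoning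

inverse : ∀ {d} → d ≢ 0ℚ → Σ ℚ λ w → w * d ≡ 1ℚ
inverse {d} d≢0 = ℚ.1/ d , ℚP.*-inverseˡ d
  where instance _ = ℚ.≢-nonZero d≢0

x*w*d≡x : ∀ x {w d} → w * d ≡ 1ℚ → x * w * d ≡ x
x*w*d≡x x {w} {d} w*d≡1 = trans (ℚP.*-assoc x w d) (trans (cong (x *_) w*d≡1) (ℚP.*-identityʳ x))

m∣n! : ∀ {m n} → 0 ℕ.< m → m ℕ.≤ n → m ℕDiv.∣ n ℕ.!
m∣n! {suc r} _ m≤n = ∣-trans (m∣m*n (r ℕ.!)) (m≤n⇒m!∣n! m≤n)

larger-prime : ∀ n → Σ ℕ λ q → Prime q × n ℕ.< q
larger-prime n = go (PrimeFactorisation.factors f)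
                    (PrimeFactorisation.isFactorisation f)
                    (PrimeFactorisation.factorsPrime f)
  where
  f = factorise (suc (n ℕ.!))
  -- A prime factor q ≤ n of n! + 1 would divide n! and hence 1.
  go : (qs : List ℕ) → suc (n ℕ.!) ≡ product qs → All Prime qs → Σ ℕ λ q → Prime q × n ℕ.< q
  go [] n!+1≡1 _ = ⊥-elim (ℕP.<⇒≢ (ℕP.1≤n! n) (sym (ℕP.suc-injective n!+1≡1)))
  go (q ∷ qs) n!+1≡q*qs (q-prime All.∷ _) with n ℕP.<? q
  ... | yes n<q = q , q-prime , n<q
  ... | no n≮q = ⊥-elim (ℕP.<⇒≢ 1<q (sym (∣1⇒≡1 q∣1)))
    where
    1<q : 1 ℕ.< q
    1<q = ℕ.nonTrivial⇒n>1 q {{prime⇒nonTrivial q-prime}}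
    q∣n!+1 : q ℕDiv.∣ n ℕ.! ℕ.+ 1
    q∣n!+1 = subst (q ℕDiv.∣_) (trans (sym n!+1≡q*qs) (ℕP.+-comm 1 (n ℕ.!))) (m∣m*n (product qs))
    q∣1 : q ℕDiv.∣ 1
    q∣1 = ∣m+n∣m⇒∣n q∣n!+1 (m∣n! (ℕP.<⇒≤ 1<q) (ℕP.≮⇒≥ n≮q))

record HomToℚ (R : DRing) : Set where
  field
    ⟦_⟧    : DRing.Carrier R → ℚ
    ⟦+⟧    : ∀ a b → ⟦ DRing.addR R a b ⟧ ≡ ⟦ a ⟧ + ⟦ b ⟧
    ⟦*⟧    : ∀ a b → ⟦ DRing.mulR R a b ⟧ ≡ ⟦ a ⟧ * ⟦ b ⟧
    ⟦-⟧    : ∀ a → ⟦ DRing.negR R a ⟧ ≡ - ⟦ a ⟧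
    ⟦0⟧    : ⟦ DRing.zeroR R ⟧ ≡ 0ℚ
    ⟦1⟧    : ⟦ DRing.oneR R ⟧ ≡ 1ℚ
    ⟦zero⟧ : ∀ a → DRing.isZeroR R a ≡ true → ⟦ a ⟧ ≡ 0ℚ

ℤ-hom : HomToℚ ℤ-DRing
ℤ-hom = record
  { ⟦_⟧ = ι ; ⟦+⟧ = ι-+ ; ⟦*⟧ = ι-* ; ⟦-⟧ = ι-neg ; ⟦0⟧ = ι-lit 0 ; ⟦1⟧ = ι-lit 1
  ; ⟦zero⟧ = λ { (+ 0) _ → ι-lit 0 } }

module EvalAt {R : DRing} (h : HomToℚ R) (c : ℚ) where
  open DRing R
  open PolyOps R
  open HomToℚ h

  eval : List Carrier → ℚ
  eval []       = 0ℚ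
  eval (a ∷ as) = ⟦ a ⟧ + c * eval as

  eval-addP : ∀ as bs → eval (addP as bs) ≡ eval as + eval bs
  eval-addP []       bs       = sym (ℚP.+-identityˡ _)
  eval-addP (a ∷ as) []       = sym (ℚP.+-identityʳ _)
  eval-addP (a ∷ as) (b ∷ bs) rewrite ⟦+⟧ a b | eval-addP as bs = rearrange ⟦ a ⟧ ⟦ b ⟧ (eval as) (eval bs)
    where
    rearrange : ∀ x y s t → (x + y) + c * (s + t) ≡ (x + c * s) + (y + c * t)
    rearrange x y s t = solve (x ∷ y ∷ s ∷ t ∷ c ∷ []) ℚ-ring

  eval-scale : ∀ a bs → eval (map (mulR a) bs) ≡ ⟦ a ⟧ * eval bs
  eval-scale a []       = sym (ℚP.*-zeroʳ ⟦ a ⟧)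
  eval-scale a (b ∷ bs) rewrite ⟦*⟧ a b | eval-scale a bs = rearrange ⟦ a ⟧ ⟦ b ⟧ (eval bs)
    where
    rearrange : ∀ x y t → x * y + c * (x * t) ≡ x * (y + c * t)
    rearrange x y t = solve (x ∷ y ∷ t ∷ c ∷ []) ℚ-ring

  eval-mulP : ∀ as bs → eval (mulP as bs) ≡ eval as * eval bs
  eval-mulP []       bs = sym (ℚP.*-zeroˡ (eval bs))
  eval-mulP (a ∷ as) bs = begin
    eval (addP (map (mulR a) bs) (zeroR ∷ mulP as bs))
      ≡⟨ eval-addP (map (mulR a) bs) (zeroR ∷ mulP as bs) ⟩
    eval (map (mulR a) bs) + (⟦ zeroR ⟧ + c * eval (mulP as bs))
      ≡⟨ cong₂ (λ s t → s + (t + c * eval (mulP as bs))) (eval-scale a bs) ⟦0⟧ ⟩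
    ⟦ a ⟧ * eval bs + (0ℚ + c * eval (mulP as bs))
      ≡⟨ cong (λ t → ⟦ a ⟧ * eval bs + (0ℚ + c * t)) (eval-mulP as bs) ⟩
    ⟦ a ⟧ * eval bs + (0ℚ + c * (eval as * eval bs))
      ≡⟨ rearrange ⟦ a ⟧ (eval bs) (eval as) ⟩
    (⟦ a ⟧ + c * eval as) * eval bs ∎
    where
    open ≡-Reasoning
    rearrange : ∀ x t s → x * t + (0ℚ + c * (s * t)) ≡ (x + c * s) * t
    rearrange x t s = solve (x ∷ t ∷ s ∷ c ∷ []) ℚ-ring

  eval-neg : ∀ as → eval (map negR as) ≡ - eval as
  eval-neg []       = refl
  eval-neg (a ∷ as) rewrite ⟦-⟧ a | eval-neg as = rearrange ⟦ a ⟧ (eval as)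
    where
    rearrange : ∀ x t → - x + c * - t ≡ - (x + c * t)
    rearrange x t = solve (x ∷ t ∷ c ∷ []) ℚ-ring

  eval-allZero : ∀ as → allZero as ≡ true → eval as ≡ 0ℚ
  eval-allZero []       _ = refl
  eval-allZero (a ∷ as) all≡0 with isZeroR a in a≡0 | allZero as in as≡0
  ... | true  | true = begin
    ⟦ a ⟧ + c * eval as ≡⟨ cong₂ (λ s t → s + c * t) (⟦zero⟧ a a≡0) (eval-allZero as as≡0) ⟩
    0ℚ + c * 0ℚ         ≡⟨ ℚP.+-identityˡ (c * 0ℚ) ⟩
    c * 0ℚ              ≡⟨ ℚP.*-zeroʳ c ⟩
    0ℚ                  ∎
    where open ≡-Reasoning
  ... | true  | false with () ← all≡0
  ... | false | _     with () ← all≡0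

  eval-one : eval (oneR ∷ []) ≡ 1ℚ
  eval-one = trans (cong₂ (λ s t → s + t) ⟦1⟧ (ℚP.*-zeroʳ c)) (ℚP.+-identityʳ 1ℚ)

  hom : HomToℚ (Poly R)
  hom = record
    { ⟦_⟧ = eval ; ⟦+⟧ = eval-addP ; ⟦*⟧ = eval-mulP ; ⟦-⟧ = eval-neg ; ⟦0⟧ = refl
    ; ⟦1⟧ = eval-one ; ⟦zero⟧ = eval-allZero }

chord-x : (A ℓ x₁ x₂ : ℚ) → ℚ
chord-x A ℓ x₁ x₂ = ((ℓ * ℓ - A) - x₁) - x₂

chord-y : (A ℓ x₁ y₁ x₂ : ℚ) → ℚ
chord-y A ℓ x₁ y₁ x₂ = ℓ * (x₁ - chord-x A ℓ x₁ x₂) - y₁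

module Weierstrass (A B C : ℚ) where

  IsOnCurve : ℚ → ℚ → Set
  IsOnCurve x y = y * y ≡ x * x * x + A * x * x + B * x + C

  -- t³ + A t² + B t + C − (ℓ (t − x₁) + y₁)² and (t − x₁) (t − x₂) (t − x₃) are monic cubics with
  -- the same t² coefficient, so their difference is a linear polynomial α t + β.
  module ChordRemainder (x₁ y₁ x₂ ℓ : ℚ) where
    x₃ y₃ α β : ℚ
    x₃ = chord-x A ℓ x₁ x₂
    y₃ = chord-y A ℓ x₁ y₁ x₂
    α  = B + 2 * ℓ * ℓ * x₁ - 2 * ℓ * y₁ - (x₁ * x₂ + x₁ * x₃ + x₂ * x₃)
    β  = C - ℓ * ℓ * x₁ * x₁ + 2 * ℓ * y₁ * x₁ - y₁ * y₁ + x₁ * x₂ * x₃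

    remainder-x₁ : α * x₁ + β ≡ (x₁ * x₁ * x₁ + A * x₁ * x₁ + B * x₁ + C) - y₁ * y₁
    remainder-x₁ = identity A B C x₁ y₁ x₂ ℓ
      where
      identity : ∀ A B C x₁ y₁ x₂ ℓ →
        (B + 2 * ℓ * ℓ * x₁ - 2 * ℓ * y₁
           - (x₁ * x₂ + x₁ * (((ℓ * ℓ - A) - x₁) - x₂) + x₂ * (((ℓ * ℓ - A) - x₁) - x₂))) * x₁
        + (C - ℓ * ℓ * x₁ * x₁ + 2 * ℓ * y₁ * x₁ - y₁ * y₁ + x₁ * x₂ * (((ℓ * ℓ - A) - x₁) - x₂))
        ≡ (x₁ * x₁ * x₁ + A * x₁ * x₁ + B * x₁ + C) - y₁ * y₁
      identity A B C x₁ y₁ x₂ ℓ = solve (A ∷ B ∷ C ∷ x₁ ∷ y₁ ∷ x₂ ∷ ℓ ∷ []) ℚ-ring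

    remainder-x₂ : α * x₂ + β
                 ≡ (x₂ * x₂ * x₂ + A * x₂ * x₂ + B * x₂ + C) - (ℓ * (x₂ - x₁) + y₁) * (ℓ * (x₂ - x₁) + y₁)
    remainder-x₂ = identity A B C x₁ y₁ x₂ ℓ
      where
      identity : ∀ A B C x₁ y₁ x₂ ℓ →
        (B + 2 * ℓ * ℓ * x₁ - 2 * ℓ * y₁
           - (x₁ * x₂ + x₁ * (((ℓ * ℓ - A) - x₁) - x₂) + x₂ * (((ℓ * ℓ - A) - x₁) - x₂))) * x₂
        + (C - ℓ * ℓ * x₁ * x₁ + 2 * ℓ * y₁ * x₁ - y₁ * y₁ + x₁ * x₂ * (((ℓ * ℓ - A) - x₁) - x₂))
        ≡ (x₂ * x₂ * x₂ + A * x₂ * x₂ + B * x₂ + C) - (ℓ * (x₂ - x₁) + y₁) * (ℓ * (x₂ - x₁) + y₁)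
      identity A B C x₁ y₁ x₂ ℓ = solve (A ∷ B ∷ C ∷ x₁ ∷ y₁ ∷ x₂ ∷ ℓ ∷ []) ℚ-ring

    remainder-x₃ : α * x₃ + β ≡ (x₃ * x₃ * x₃ + A * x₃ * x₃ + B * x₃ + C) - y₃ * y₃
    remainder-x₃ = identity A B C x₁ y₁ x₂ ℓ
      where
      identity : ∀ A B C x₁ y₁ x₂ ℓ →
        (B + 2 * ℓ * ℓ * x₁ - 2 * ℓ * y₁
           - (x₁ * x₂ + x₁ * (((ℓ * ℓ - A) - x₁) - x₂) + x₂ * (((ℓ * ℓ - A) - x₁) - x₂)))
          * (((ℓ * ℓ - A) - x₁) - x₂)
        + (C - ℓ * ℓ * x₁ * x₁ + 2 * ℓ * y₁ * x₁ - y₁ * y₁ + x₁ * x₂ * (((ℓ * ℓ - A) - x₁) - x₂))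
        ≡ ((((ℓ * ℓ - A) - x₁) - x₂) * (((ℓ * ℓ - A) - x₁) - x₂) * (((ℓ * ℓ - A) - x₁) - x₂)
            + A * (((ℓ * ℓ - A) - x₁) - x₂) * (((ℓ * ℓ - A) - x₁) - x₂)
            + B * (((ℓ * ℓ - A) - x₁) - x₂) + C)
          - (ℓ * (x₁ - (((ℓ * ℓ - A) - x₁) - x₂)) - y₁) * (ℓ * (x₁ - (((ℓ * ℓ - A) - x₁) - x₂)) - y₁)
      identity A B C x₁ y₁ x₂ ℓ = solve (A ∷ B ∷ C ∷ x₁ ∷ y₁ ∷ x₂ ∷ ℓ ∷ []) ℚ-ring

    third-on-curve : IsOnCurve x₁ y₁ → α ≡ 0ℚ → IsOnCurve x₃ y₃
    third-on-curve on₁ α≡0 = sym (x-y≡0⇒x≡y (begin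
      (x₃ * x₃ * x₃ + A * x₃ * x₃ + B * x₃ + C) - y₃ * y₃ ≡⟨ remainder-x₃ ⟨
      α * x₃ + β    ≡⟨ cong (λ a → a * x₃ + β) α≡0 ⟩
      0ℚ * x₃ + β   ≡⟨ cong (_+ β) (trans (ℚP.*-zeroˡ x₃) (sym (ℚP.*-zeroˡ x₁))) ⟩
      0ℚ * x₁ + β   ≡⟨ cong (λ a → a * x₁ + β) α≡0 ⟨
      α * x₁ + β    ≡⟨ trans remainder-x₁ (x≡y⇒x-y≡0 (sym on₁)) ⟩
      0ℚ            ∎))
      where open ≡-Reasoning

  chord-on-curve : ∀ {x₁ y₁ x₂ y₂ ℓ} → IsOnCurve x₁ y₁ → IsOnCurve x₂ y₂ →
                   x₂ - x₁ ≢ 0ℚ → ℓ * (x₂ - x₁) ≡ y₂ - y₁ →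
                   IsOnCurve (chord-x A ℓ x₁ x₂) (chord-y A ℓ x₁ y₁ x₂)
  chord-on-curve {x₁} {y₁} {x₂} {y₂} {ℓ} on₁ on₂ x₂-x₁≢0 slope = third-on-curve on₁ α≡0
    where
    open ChordRemainder x₁ y₁ x₂ ℓ
    open ≡-Reasoning

    line-at-x₂ : ℓ * (x₂ - x₁) + y₁ ≡ y₂
    line-at-x₂ = trans (cong (_+ y₁) slope) (rearrange y₂ y₁)
      where
      rearrange : ∀ a b → a - b + b ≡ a
      rearrange a b = solve (a ∷ b ∷ []) ℚ-ring

    vanishes-x₁ : α * x₁ + β ≡ 0ℚ
    vanishes-x₁ = trans remainder-x₁ (x≡y⇒x-y≡0 (sym on₁))

    vanishes-x₂ : α * x₂ + β ≡ 0ℚ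
    vanishes-x₂ = trans remainder-x₂
      (trans (cong (λ y → (x₂ * x₂ * x₂ + A * x₂ * x₂ + B * x₂ + C) - y * y) line-at-x₂) (x≡y⇒x-y≡0 (sym on₂)))

    α≡0 : α ≡ 0ℚ
    α≡0 = x*y≡0⇒x≡0 x₂-x₁≢0 (begin
      α * (x₂ - x₁)               ≡⟨ rearrange α β x₁ x₂ ⟩
      (α * x₂ + β) - (α * x₁ + β) ≡⟨ cong₂ _-_ vanishes-x₂ vanishes-x₁ ⟩
      0ℚ - 0ℚ                     ≡⟨ ℚP.+-inverseʳ 0ℚ ⟩
      0ℚ                          ∎)
      where
      rearrange : ∀ α β x₁ x₂ → α * (x₂ - x₁) ≡ (α * x₂ + β) - (α * x₁ + β)
      rearrange α β x₁ x₂ = solve (α ∷ β ∷ x₁ ∷ x₂ ∷ []) ℚ-ring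

  -- For the tangent (x₂ = x₁) the coefficient α is f′(x₁) − 2 ℓ y₁, where f is the cubic.
  tangent-on-curve : ∀ {x₁ y₁ ℓ} → IsOnCurve x₁ y₁ → ℓ * (2 * y₁) ≡ 3 * (x₁ * x₁) + 2 * A * x₁ + B →
                     IsOnCurve (chord-x A ℓ x₁ x₁) (chord-y A ℓ x₁ y₁ x₁)
  tangent-on-curve {x₁} {y₁} {ℓ} on₁ slope = third-on-curve on₁ (begin
    α                                                ≡⟨ identity A B x₁ y₁ ℓ ⟩
    (3 * (x₁ * x₁) + 2 * A * x₁ + B) - ℓ * (2 * y₁)  ≡⟨ x≡y⇒x-y≡0 (sym slope) ⟩
    0ℚ                                               ∎)
    where
    open ChordRemainder x₁ y₁ x₁ ℓ
    open ≡-Reasoning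
    identity : ∀ A B x₁ y₁ ℓ →
      B + 2 * ℓ * ℓ * x₁ - 2 * ℓ * y₁
        - (x₁ * x₁ + x₁ * (((ℓ * ℓ - A) - x₁) - x₁) + x₁ * (((ℓ * ℓ - A) - x₁) - x₁))
      ≡ (3 * (x₁ * x₁) + 2 * A * x₁ + B) - ℓ * (2 * y₁)
    identity A B x₁ y₁ ℓ = solve (A ∷ B ∷ x₁ ∷ y₁ ∷ ℓ ∷ []) ℚ-ring

-- The local ring ℤ₍ₚ₎ ⊂ ℚ, its units and its maximal ideal p ℤ₍ₚ₎; membership is witnessed by a
-- representation with denominator prime to p.
module Localisation (p : ℕ) (p-prime : Prime p) where

  π : ℚ
  π = ι (+ p)

  Divisible : ℤ → Set
  Divisible z = + p ℤDiv.∣ z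

  1<p : 1 ℕ.< p
  1<p = ℕ.nonTrivial⇒n>1 p {{prime⇒nonTrivial p-prime}}

  ¬Divisible-small : ∀ z → 0 ℕ.< ℤ.∣ z ∣ → ℤ.∣ z ∣ ℕ.< p → ¬ Divisible z
  ¬Divisible-small z 0<∣z∣ ∣z∣<p p∣z =
    ℕP.<⇒≱ ∣z∣<p (ℕDiv.∣⇒≤ {{ℕ.>-nonZero 0<∣z∣}} (ℤDiv.∣⇒∣ᵤ p∣z))

  ¬Divisible-1 : ¬ Divisible (+ 1)
  ¬Divisible-1 = ¬Divisible-small (+ 1) ℕP.≤-refl 1<p

  Divisible-* : ∀ a b → Divisible (a ℤ.* b) → Divisible a ⊎ Divisible b
  Divisible-* a b p∣ab
    with euclidsLemma ℤ.∣ a ∣ ℤ.∣ b ∣ p-prime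
           (subst (p ℕDiv.∣_) (ℤP.abs-* a b) (ℤDiv.∣⇒∣ᵤ p∣ab))
  ... | inj₁ p∣a = inj₁ (ℤDiv.∣ᵤ⇒∣ p∣a)
  ... | inj₂ p∣b = inj₂ (ℤDiv.∣ᵤ⇒∣ p∣b)

  ¬Divisible-* : ∀ {a b} → ¬ Divisible a → ¬ Divisible b → ¬ Divisible (a ℤ.* b)
  ¬Divisible-* {a} {b} p∤a p∤b p∣ab with Divisible-* a b p∣ab
  ... | inj₁ p∣a = p∤a p∣a
  ... | inj₂ p∣b = p∤b p∣b

  Divisible-p* : ∀ z → Divisible (+ p ℤ.* z)
  Divisible-p* z = ℤDiv.divides z (ℤP.*-comm (+ p) z)

  ι≢0 : ∀ {z} → ¬ Divisible z → ι z ≢ 0ℚ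
  ι≢0 {z} p∤z ιz≡0 with ι-injective {z} {+ 0} (trans ιz≡0 (sym (ι-lit 0)))
  ... | refl = p∤z (ℤDiv.divides (+ 0) refl)

  π≢0 : π ≢ 0ℚ
  π≢0 πz≡0 = ℕP.<⇒≢ (ℕP.<-trans ℕP.0<1+n 1<p) (sym (cong ℤ.∣_∣ (ι-injective (trans πz≡0 (sym (ι-lit 0))))))

  record Integral (q : ℚ) : Set where
    constructor integral
    field
      den num : ℤ
      p∤den   : ¬ Divisible den
      q*den   : q * ι den ≡ ι num

  record Unit (q : ℚ) : Set where
    constructor unit
    field
      den num : ℤ
      p∤den   : ¬ Divisible den
      p∤num   : ¬ Divisible num
      q*den   : q * ι den ≡ ι num

  record InIdeal (q : ℚ) : Set where
    constructor inIdeal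
    field
      cofactor          : ℚ
      cofactor-integral : Integral cofactor
      q≡π*cofactor      : q ≡ π * cofactor

  Integral-ι : ∀ z → Integral (ι z)
  Integral-ι z = integral (+ 1) z ¬Divisible-1 (trans (cong (ι z *_) (ι-lit 1)) (ℚP.*-identityʳ (ι z)))

  Integral-lit : ∀ k → Integral (+ k ℚ./ 1)
  Integral-lit k = subst Integral (ι-lit k) (Integral-ι (+ k))

  Integral-π : Integral π
  Integral-π = Integral-ι (+ p)

  Integral-+ : ∀ {a b} → Integral a → Integral b → Integral (a + b)
  Integral-+ {a} {b} (integral u₁ z₁ p∤u₁ e₁) (integral u₂ z₂ p∤u₂ e₂) =
    integral (u₁ ℤ.* u₂) (z₁ ℤ.* u₂ ℤ.+ z₂ ℤ.* u₁) (¬Divisible-* p∤u₁ p∤u₂) (begin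
      (a + b) * ι (u₁ ℤ.* u₂)                  ≡⟨ cong ((a + b) *_) (ι-* u₁ u₂) ⟩
      (a + b) * (ι u₁ * ι u₂)                  ≡⟨ rearrange a b (ι u₁) (ι u₂) ⟩
      (a * ι u₁) * ι u₂ + (b * ι u₂) * ι u₁    ≡⟨ cong₂ (λ s t → s * ι u₂ + t * ι u₁) e₁ e₂ ⟩
      ι z₁ * ι u₂ + ι z₂ * ι u₁                ≡⟨ cong₂ _+_ (ι-* z₁ u₂) (ι-* z₂ u₁) ⟨
      ι (z₁ ℤ.* u₂) + ι (z₂ ℤ.* u₁)            ≡⟨ ι-+ (z₁ ℤ.* u₂) (z₂ ℤ.* u₁) ⟨
      ι (z₁ ℤ.* u₂ ℤ.+ z₂ ℤ.* u₁)              ∎)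
    where
    open ≡-Reasoning
    rearrange : ∀ a b x y → (a + b) * (x * y) ≡ (a * x) * y + (b * y) * x
    rearrange a b x y = solve (a ∷ b ∷ x ∷ y ∷ []) ℚ-ring

  Integral-* : ∀ {a b} → Integral a → Integral b → Integral (a * b)
  Integral-* {a} {b} (integral u₁ z₁ p∤u₁ e₁) (integral u₂ z₂ p∤u₂ e₂) =
    integral (u₁ ℤ.* u₂) (z₁ ℤ.* z₂) (¬Divisible-* p∤u₁ p∤u₂) (begin
      (a * b) * ι (u₁ ℤ.* u₂)     ≡⟨ cong ((a * b) *_) (ι-* u₁ u₂) ⟩
      (a * b) * (ι u₁ * ι u₂)     ≡⟨ rearrange a b (ι u₁) (ι u₂) ⟩
      (a * ι u₁) * (b * ι u₂)     ≡⟨ cong₂ _*_ e₁ e₂ ⟩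
      ι z₁ * ι z₂                 ≡⟨ ι-* z₁ z₂ ⟨
      ι (z₁ ℤ.* z₂)               ∎)
    where
    open ≡-Reasoning
    rearrange : ∀ a b x y → (a * b) * (x * y) ≡ (a * x) * (b * y)
    rearrange a b x y = solve (a ∷ b ∷ x ∷ y ∷ []) ℚ-ring

  Integral-neg : ∀ {a} → Integral a → Integral (- a)
  Integral-neg {a} (integral u z p∤u e) =
    integral u (ℤ.- z) p∤u (trans (sym (ℚP.neg-distribˡ-* a (ι u))) (trans (cong -_ e) (sym (ι-neg z))))

  Integral-- : ∀ {a b} → Integral a → Integral b → Integral (a - b)
  Integral-- ia ib = Integral-+ ia (Integral-neg ib)

  Unit⇒Integral : ∀ {a} → Unit a → Integral a
  Unit⇒Integral (unit u z p∤u _ e) = integral u z p∤u e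

  Unit-ι : ∀ {z} → ¬ Divisible z → Unit (ι z)
  Unit-ι {z} p∤z = unit (+ 1) z ¬Divisible-1 p∤z (Integral.q*den (Integral-ι z))

  Unit-* : ∀ {a b} → Unit a → Unit b → Unit (a * b)
  Unit-* {a} {b} (unit u₁ z₁ p∤u₁ p∤z₁ e₁) (unit u₂ z₂ p∤u₂ p∤z₂ e₂) =
    unit (u₁ ℤ.* u₂) (z₁ ℤ.* z₂) (¬Divisible-* p∤u₁ p∤u₂) (¬Divisible-* p∤z₁ p∤z₂)
         (Integral.q*den (Integral-* {a} {b} (integral u₁ z₁ p∤u₁ e₁) (integral u₂ z₂ p∤u₂ e₂)))

  Unit≢0 : ∀ {a} → Unit a → a ≢ 0ℚ
  Unit≢0 (unit u z _ p∤z e) refl = ι≢0 p∤z (trans (sym e) (ℚP.*-zeroˡ (ι u)))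

  Unit-neg : ∀ {a} → Unit a → Unit (- a)
  Unit-neg {a} (unit u z p∤u p∤z a*u≡z) =
    unit u (ℤ.- z) p∤u (p∤z ∘ λ p∣-z → subst Divisible (ℤP.neg-involutive z) (ℤDiv.∣m⇒∣-m p∣-z))
         (trans (sym (ℚP.neg-distribˡ-* a (ι u))) (trans (cong -_ a*u≡z) (sym (ι-neg z))))

  Unit-ratio : ∀ {q} a b → ¬ Divisible (+ a) → ¬ Divisible (+ b) → q * (+ b ℚ./ 1) ≡ + a ℚ./ 1 → Unit q
  Unit-ratio {q} a b p∤a p∤b q*b≡a =
    unit (+ b) (+ a) p∤b p∤a (trans (cong (q *_) (ι-lit b)) (trans q*b≡a (sym (ι-lit a))))

  Integral-ratio : ∀ {q} a b → ¬ Divisible (+ b) → q * (+ b ℚ./ 1) ≡ + a ℚ./ 1 → Integral q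
  Integral-ratio {q} a b p∤b q*b≡a =
    integral (+ b) (+ a) p∤b (trans (cong (q *_) (ι-lit b)) (trans q*b≡a (sym (ι-lit a))))

  record Inverse (a : ℚ) : Set where
    field
      a⁻¹       : ℚ
      a⁻¹-unit  : Unit a⁻¹
      a⁻¹*a≡1   : a⁻¹ * a ≡ 1ℚ

  Unit-inverse : ∀ {a} → Unit a → Inverse a
  Unit-inverse {a} (unit u z p∤u p∤z a*u≡z) = record
    { a⁻¹ = ι u * ℚ.1/ ι z
    ; a⁻¹-unit = unit z u p∤z p∤u (x*w*d≡x (ι u) (ℚP.*-inverseˡ (ι z)))
    ; a⁻¹*a≡1 = begin
        ι u * ℚ.1/ ι z * a      ≡⟨ rearrange (ι u) (ℚ.1/ ι z) a ⟩
        (a * ι u) * ℚ.1/ ι z    ≡⟨ cong (_* ℚ.1/ ι z) a*u≡z ⟩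
        ι z * ℚ.1/ ι z          ≡⟨ ℚP.*-inverseʳ (ι z) ⟩
        1ℚ                      ∎ }
    where
    open ≡-Reasoning
    instance _ = ℚ.≢-nonZero (ι≢0 p∤z)
    rearrange : ∀ x y a → x * y * a ≡ (a * x) * y
    rearrange x y a = solve (x ∷ y ∷ a ∷ []) ℚ-ring

  InIdeal-π* : ∀ {W} → Integral W → InIdeal (π * W)
  InIdeal-π* {W} iW = inIdeal W iW refl

  InIdeal-+ : ∀ {a b} → InIdeal a → InIdeal b → InIdeal (a + b)
  InIdeal-+ (inIdeal W₁ i₁ refl) (inIdeal W₂ i₂ refl) =
    inIdeal (W₁ + W₂) (Integral-+ i₁ i₂) (sym (ℚP.*-distribˡ-+ π W₁ W₂))

  InIdeal-neg : ∀ {a} → InIdeal a → InIdeal (- a)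
  InIdeal-neg (inIdeal W i refl) = inIdeal (- W) (Integral-neg i) (ℚP.neg-distribʳ-* π W)

  InIdeal-*ʳ : ∀ {a b} → InIdeal a → Integral b → InIdeal (a * b)
  InIdeal-*ʳ {b = b} (inIdeal W i refl) ib = inIdeal (W * b) (Integral-* i ib) (ℚP.*-assoc π W b)

  InIdeal-*ˡ : ∀ {a b} → Integral a → InIdeal b → InIdeal (a * b)
  InIdeal-*ˡ {a} {b} ia ib = subst InIdeal (ℚP.*-comm b a) (InIdeal-*ʳ ib ia)

  Unit-+-InIdeal : ∀ {a b} → Unit a → InIdeal b → Unit (a + b)
  Unit-+-InIdeal {a} (unit u z p∤u p∤z a*u≡z) (inIdeal W (integral u′ w p∤u′ W*u′≡w) refl) =
    unit (u ℤ.* u′) (z ℤ.* u′ ℤ.+ + p ℤ.* (w ℤ.* u)) (¬Divisible-* p∤u p∤u′) p∤num (begin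
      (a + π * W) * ι (u ℤ.* u′)                  ≡⟨ cong ((a + π * W) *_) (ι-* u u′) ⟩
      (a + π * W) * (ι u * ι u′)                  ≡⟨ rearrange a π W (ι u) (ι u′) ⟩
      (a * ι u) * ι u′ + π * ((W * ι u′) * ι u)   ≡⟨ cong₂ (λ s t → s * ι u′ + π * (t * ι u)) a*u≡z W*u′≡w ⟩
      ι z * ι u′ + π * (ι w * ι u)                ≡⟨ cong₂ (λ s t → s + π * t) (ι-* z u′) (ι-* w u) ⟨
      ι (z ℤ.* u′) + π * ι (w ℤ.* u)              ≡⟨ cong (λ t → ι (z ℤ.* u′) + t) (ι-* (+ p) (w ℤ.* u)) ⟨
      ι (z ℤ.* u′) + ι (+ p ℤ.* (w ℤ.* u))        ≡⟨ ι-+ (z ℤ.* u′) (+ p ℤ.* (w ℤ.* u)) ⟨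
      ι (z ℤ.* u′ ℤ.+ + p ℤ.* (w ℤ.* u))          ∎)
    where
    open ≡-Reasoning
    p∤num : ¬ Divisible (z ℤ.* u′ ℤ.+ + p ℤ.* (w ℤ.* u))
    p∤num p∣num = ¬Divisible-* p∤z p∤u′ (ℤDiv.∣m+n∣n⇒∣m p∣num (Divisible-p* (w ℤ.* u)))
    rearrange : ∀ a π W x y → (a + π * W) * (x * y) ≡ (a * x) * y + π * ((W * y) * x)
    rearrange a π W x y = solve (a ∷ π ∷ W ∷ x ∷ y ∷ []) ℚ-ring

  infix 4 _≡ₚ_
  record _≡ₚ_ (a b : ℚ) : Set where
    constructor ≡ₚ-intro
    field difference : InIdeal (a - b)

  ≡⇒≡ₚ : ∀ {a b} → a ≡ b → a ≡ₚ b
  ≡⇒≡ₚ {a} refl = ≡ₚ-intro (inIdeal 0ℚ (Integral-lit 0) (trans (ℚP.+-inverseʳ a) (sym (ℚP.*-zeroʳ π))))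

  ≡ₚ-trans : ∀ {a b c} → a ≡ₚ b → b ≡ₚ c → a ≡ₚ c
  ≡ₚ-trans {a} {b} {c} (≡ₚ-intro a-b) (≡ₚ-intro b-c) = ≡ₚ-intro (subst InIdeal (rearrange a b c) (InIdeal-+ a-b b-c))
    where
    rearrange : ∀ a b c → (a - b) + (b - c) ≡ a - c
    rearrange a b c = solve (a ∷ b ∷ c ∷ []) ℚ-ring

  ≡ₚ-+ : ∀ {a b c d} → a ≡ₚ b → c ≡ₚ d → a + c ≡ₚ b + d
  ≡ₚ-+ {a} {b} {c} {d} (≡ₚ-intro a-b) (≡ₚ-intro c-d) = ≡ₚ-intro (subst InIdeal (rearrange a b c d) (InIdeal-+ a-b c-d))
    where
    rearrange : ∀ a b c d → (a - b) + (c - d) ≡ (a + c) - (b + d)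
    rearrange a b c d = solve (a ∷ b ∷ c ∷ d ∷ []) ℚ-ring

  ≡ₚ-neg : ∀ {a b} → a ≡ₚ b → - a ≡ₚ - b
  ≡ₚ-neg {a} {b} (≡ₚ-intro a-b) = ≡ₚ-intro (subst InIdeal (rearrange a b) (InIdeal-neg a-b))
    where
    rearrange : ∀ a b → - (a - b) ≡ (- a) - (- b)
    rearrange a b = solve (a ∷ b ∷ []) ℚ-ring

  ≡ₚ-* : ∀ {a b c d} → Integral a → Integral d → a ≡ₚ b → c ≡ₚ d → a * c ≡ₚ b * d
  ≡ₚ-* {a} {b} {c} {d} ia id (≡ₚ-intro a-b) (≡ₚ-intro c-d) =
    ≡ₚ-intro (subst InIdeal (rearrange a b c d) (InIdeal-+ (InIdeal-*ˡ ia c-d) (InIdeal-*ʳ a-b id)))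
    where
    rearrange : ∀ a b c d → a * (c - d) + (a - b) * d ≡ a * c - b * d
    rearrange a b c d = solve (a ∷ b ∷ c ∷ d ∷ []) ℚ-ring

  π*≡ₚ0 : ∀ {t} → Integral t → π * t ≡ₚ 0ℚ
  π*≡ₚ0 {t} it = ≡ₚ-intro (subst InIdeal (sym (ℚP.+-identityʳ (π * t))) (InIdeal-π* it))

  ≡ₚ0⇒InIdeal : ∀ {a} → a ≡ₚ 0ℚ → InIdeal a
  ≡ₚ0⇒InIdeal {a} (≡ₚ-intro a-0) = subst InIdeal (ℚP.+-identityʳ a) a-0

-- Specialisation m ↦ μ, n ↦ ν of ℚ(m,n), defined on the fractions whose denominator does not vanish.
module Specialisation (μ ν : ℚ) where
  open HomToℚ (EvalAt.hom (EvalAt.hom ℤ-hom μ) ν)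
  open DField ℚmn using (Carrier; oneR; addR; mulR; negR; invF; isZeroR)
  open Curve ℚmn using (Point; O; aff; add; eqK; two; three; _-K_)

  infix 4 _↦_ _↦ₚ_

  record _↦_ (e : Carrier) (q : ℚ) : Set where
    constructor ↦-intro
    field
      den≢0 : ⟦ proj₂ e ⟧ ≢ 0ℚ
      num≡  : ⟦ proj₁ e ⟧ ≡ q * ⟦ proj₂ e ⟧

  _↦ₚ_ : Point → ℚ × ℚ → Set
  O       ↦ₚ _       = ⊥
  aff u v ↦ₚ (x , y) = u ↦ x × v ↦ y

  ↦-add : ∀ {a b q r} → a ↦ q → b ↦ r → addR a b ↦ q + r
  ↦-add {a₁ , a₂} {b₁ , b₂} {q} {r} (↦-intro a₂≢0 a₁≡) (↦-intro b₂≢0 b₁≡) = ↦-intro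
    (λ e → *-≢0 a₂≢0 b₂≢0 (trans (sym (⟦*⟧ a₂ b₂)) e))
    (begin
      ⟦ DRing.addR ℤmn (mulR′ a₁ b₂) (mulR′ b₁ a₂) ⟧ ≡⟨ ⟦+⟧ (mulR′ a₁ b₂) (mulR′ b₁ a₂) ⟩
      ⟦ mulR′ a₁ b₂ ⟧ + ⟦ mulR′ b₁ a₂ ⟧           ≡⟨ cong₂ _+_ (⟦*⟧ a₁ b₂) (⟦*⟧ b₁ a₂) ⟩
      ⟦ a₁ ⟧ * ⟦ b₂ ⟧ + ⟦ b₁ ⟧ * ⟦ a₂ ⟧           ≡⟨ cong₂ (λ s t → s * ⟦ b₂ ⟧ + t * ⟦ a₂ ⟧) a₁≡ b₁≡ ⟩
      q * ⟦ a₂ ⟧ * ⟦ b₂ ⟧ + r * ⟦ b₂ ⟧ * ⟦ a₂ ⟧   ≡⟨ rearrange q r ⟦ a₂ ⟧ ⟦ b₂ ⟧ ⟩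
      (q + r) * (⟦ a₂ ⟧ * ⟦ b₂ ⟧)                ≡⟨ cong ((q + r) *_) (⟦*⟧ a₂ b₂) ⟨
      (q + r) * ⟦ mulR′ a₂ b₂ ⟧                  ∎)
    where
    open ≡-Reasoning
    mulR′ = DRing.mulR ℤmn
    rearrange : ∀ q r x y → q * x * y + r * y * x ≡ (q + r) * (x * y)
    rearrange q r x y = solve (q ∷ r ∷ x ∷ y ∷ []) ℚ-ring

  ↦-mul : ∀ {a b q r} → a ↦ q → b ↦ r → mulR a b ↦ q * r
  ↦-mul {a₁ , a₂} {b₁ , b₂} {q} {r} (↦-intro a₂≢0 a₁≡) (↦-intro b₂≢0 b₁≡) = ↦-intro
    (λ e → *-≢0 a₂≢0 b₂≢0 (trans (sym (⟦*⟧ a₂ b₂)) e))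
    (begin
      ⟦ DRing.mulR ℤmn a₁ b₁ ⟧        ≡⟨ ⟦*⟧ a₁ b₁ ⟩
      ⟦ a₁ ⟧ * ⟦ b₁ ⟧                  ≡⟨ cong₂ _*_ a₁≡ b₁≡ ⟩
      q * ⟦ a₂ ⟧ * (r * ⟦ b₂ ⟧)        ≡⟨ rearrange q r ⟦ a₂ ⟧ ⟦ b₂ ⟧ ⟩
      (q * r) * (⟦ a₂ ⟧ * ⟦ b₂ ⟧)      ≡⟨ cong ((q * r) *_) (⟦*⟧ a₂ b₂) ⟨
      (q * r) * ⟦ DRing.mulR ℤmn a₂ b₂ ⟧ ∎)
    where
    open ≡-Reasoning
    rearrange : ∀ q r x y → q * x * (r * y) ≡ (q * r) * (x * y)
    rearrange q r x y = solve (q ∷ r ∷ x ∷ y ∷ []) ℚ-ring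

  ↦-neg : ∀ {a q} → a ↦ q → negR a ↦ - q
  ↦-neg {a₁ , a₂} {q} (↦-intro a₂≢0 a₁≡) =
    ↦-intro a₂≢0 (trans (⟦-⟧ a₁) (trans (cong -_ a₁≡) (ℚP.neg-distribˡ-* q ⟦ a₂ ⟧)))

  ↦-sub : ∀ {a b q r} → a ↦ q → b ↦ r → a -K b ↦ q - r
  ↦-sub a↦q b↦r = ↦-add a↦q (↦-neg b↦r)

  ↦-zero : ∀ {a q} → a ↦ q → isZeroR a ≡ true → q ≡ 0ℚ
  ↦-zero {a₁ , a₂} {q} (↦-intro a₂≢0 a₁≡) a≡0 = x*y≡0⇒x≡0 a₂≢0 (trans (sym a₁≡) (⟦zero⟧ a₁ a≡0))

  ↦-inv : ∀ {a q w} → a ↦ q → w * q ≡ 1ℚ → invF a ↦ w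
  ↦-inv {a₁ , a₂} {q} {w} (↦-intro a₂≢0 a₁≡) w*q≡1 = ↦-intro a₁≢0 (begin
    ⟦ a₂ ⟧              ≡⟨ ℚP.*-identityˡ ⟦ a₂ ⟧ ⟨
    1ℚ * ⟦ a₂ ⟧         ≡⟨ cong (_* ⟦ a₂ ⟧) w*q≡1 ⟨
    w * q * ⟦ a₂ ⟧      ≡⟨ ℚP.*-assoc w q ⟦ a₂ ⟧ ⟩
    w * (q * ⟦ a₂ ⟧)    ≡⟨ cong (w *_) a₁≡ ⟨
    w * ⟦ a₁ ⟧          ∎)
    where
    open ≡-Reasoning
    a₁≢0 : ⟦ a₁ ⟧ ≢ 0ℚ
    a₁≢0 a₁≡0 = ℚP.1≢0 (begin
      1ℚ      ≡⟨ w*q≡1 ⟨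
      w * q   ≡⟨ cong (w *_) (x*y≡0⇒x≡0 a₂≢0 (trans (sym a₁≡) a₁≡0)) ⟩
      w * 0ℚ  ≡⟨ ℚP.*-zeroʳ w ⟩
      0ℚ      ∎)

  ↦-embed : ∀ {a q} → ⟦ a ⟧ ≡ q → embed a ↦ q
  ↦-embed {a} {q} a≡q = ↦-intro (λ 1≡0 → ℚP.1≢0 (trans (sym ⟦1⟧) 1≡0))
                                (trans a≡q (sym (trans (cong (q *_) ⟦1⟧) (ℚP.*-identityʳ q))))

  ↦-one : oneR ↦ 1ℚ
  ↦-one = ↦-embed ⟦1⟧

  ↦-two : two ↦ 2
  ↦-two = ↦-add ↦-one ↦-one

  ↦-three : three ↦ 3
  ↦-three = ↦-add ↦-two ↦-one

  m↦μ : m ↦ μ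
  m↦μ = ↦-embed (identity μ ν)
    where
    identity : ∀ μ ν → (ι (+ 0) + μ * (ι (+ 1) + μ * 0ℚ)) + ν * 0ℚ ≡ μ
    identity μ ν rewrite ι-lit 0 | ι-lit 1 = solve (μ ∷ ν ∷ []) ℚ-ring

  n↦ν : n ↦ ν
  n↦ν = ↦-embed (identity μ ν)
    where
    identity : ∀ μ ν → 0ℚ + ν * ((ι (+ 1) + μ * 0ℚ) + ν * 0ℚ) ≡ ν
    identity μ ν rewrite ι-lit 1 = solve (μ ∷ ν ∷ []) ℚ-ring

  chord-↦ : ∀ {a b c u₁ v₁ u₂ v₂ A x₁ y₁ x₂ y₂} →
            a ↦ A → u₁ ↦ x₁ → v₁ ↦ y₁ → u₂ ↦ x₂ → v₂ ↦ y₂ → x₂ - x₁ ≢ 0ℚ →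
            Σ ℚ λ ℓ → ℓ * (x₂ - x₁) ≡ y₂ - y₁
                    × add a b c (aff u₁ v₁) (aff u₂ v₂) ↦ₚ (chord-x A ℓ x₁ x₂ , chord-y A ℓ x₁ y₁ x₂)
  chord-↦ {a} {b} {c} {u₁} {v₁} {u₂} {v₂} {A} {x₁} {y₁} {x₂} {y₂} a↦ u₁↦ v₁↦ u₂↦ v₂↦ x₂-x₁≢0
    with eqK u₁ u₂ in u₁≡u₂
  ... | true  = ⊥-elim (x₂-x₁≢0 (x≡y⇒x-y≡0 (sym (x-y≡0⇒x≡y {x₁} {x₂} (↦-zero (↦-sub u₁↦ u₂↦) u₁≡u₂)))))
  ... | false = ℓ , x*w*d≡x (y₂ - y₁) w*d≡1 , (x₃↦ , ↦-sub (↦-mul ℓ↦ (↦-sub u₁↦ x₃↦)) v₁↦)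
    where
    w = proj₁ (inverse x₂-x₁≢0)
    w*d≡1 = proj₂ (inverse x₂-x₁≢0)
    ℓ : ℚ
    ℓ = (y₂ - y₁) * w
    ℓ↦ = ↦-mul (↦-sub v₂↦ v₁↦) (↦-inv (↦-sub u₂↦ u₁↦) w*d≡1)
    x₃↦ = ↦-sub (↦-sub (↦-sub (↦-mul ℓ↦ ℓ↦) a↦) u₁↦) u₂↦

  tangent-↦ : ∀ {a b c u v A B x y} → eqK u u ≡ true → isZeroR (addR v v) ≡ false →
              a ↦ A → b ↦ B → u ↦ x → v ↦ y → 2 * y ≢ 0ℚ →
              Σ ℚ λ ℓ → ℓ * (2 * y) ≡ 3 * (x * x) + 2 * A * x + B
                      × add a b c (aff u v) (aff u v) ↦ₚ (chord-x A ℓ x x , chord-y A ℓ x y x)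
  tangent-↦ {a} {b} {c} {u} {v} {A} {B} {x} {y} u≡u 2v≢0 a↦ b↦ u↦ v↦ 2y≢0
    with eqK u u | u≡u
  ... | true | refl with isZeroR (addR v v) | 2v≢0
  ...   | false | refl = ℓ , x*w*d≡x _ w*d≡1 , (x₃↦ , ↦-sub (↦-mul ℓ↦ (↦-sub u↦ x₃↦)) v↦)
    where
    w = proj₁ (inverse 2y≢0)
    w*d≡1 = proj₂ (inverse 2y≢0)
    ℓ : ℚ
    ℓ = (3 * (x * x) + 2 * A * x + B) * w
    ℓ↦ = ↦-mul (↦-add (↦-add (↦-mul ↦-three (↦-mul u↦ u↦)) (↦-mul (↦-mul ↦-two a↦) u↦)) b↦)
               (↦-inv (↦-mul ↦-two v↦) w*d≡1)
    x₃↦ = ↦-sub (↦-sub (↦-sub (↦-mul ℓ↦ ℓ↦) a↦) u↦) u↦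

module _ (p : ℕ) (p-prime : Prime p) (5≤p : 5 ℕ.≤ p) where
  open Localisation p p-prime
  open Specialisation π 2
  open DField ℚmn using (oneR; addR; mulR)
  open Curve ℚmn using (Point; O; aff; add; smul)

  A B C : ℚ
  A = 9 * (π * π) - 7
  B = 12 - 72 * (π * π)
  C = 144 * (π * π)

  open Weierstrass A B C

  1+n↦3 : addR oneR n ↦ 3
  1+n↦3 = ↦-add ↦-one n↦ν

  A↦ : coefA ↦ A
  A↦ = subst (coefA ↦_) (identity π)
         (↦-add (↦-sub ↦-one (↦-mul ↦-two (↦-mul n↦ν n↦ν))) (↦-mul (↦-mul 1+n↦3 1+n↦3) (↦-mul m↦μ m↦μ)))
    where
    identity : ∀ t → (1ℚ - 2 * (2 * 2)) + (3 * 3) * (t * t) ≡ 9 * (t * t) - 7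
    identity t = solve (t ∷ []) ℚ-ring

  B↦ : coefB ↦ B
  B↦ = subst (coefB ↦_) (identity π)
         (↦-neg (↦-mul (↦-mul (↦-mul n↦ν n↦ν) 1+n↦3)
                       (↦-add (↦-sub ↦-one n↦ν) (↦-mul (↦-mul ↦-two 1+n↦3) (↦-mul m↦μ m↦μ)))))
    where
    identity : ∀ t → - ((2 * 2) * 3 * ((1ℚ - 2) + (2 * 3) * (t * t))) ≡ 12 - 72 * (t * t)
    identity t = solve (t ∷ []) ℚ-ring

  P₁↦ : P₁ ↦ₚ (3 , 3 * π)
  P₁↦ = ↦-sub (↦-mul n↦ν n↦ν) ↦-one , subst (_ ↦_) (ℚP.*-comm π 3) (↦-mul m↦μ 1+n↦3)

  P-on-curve : IsOnCurve 3 (3 * π)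
  P-on-curve = identity π
    where
    identity : ∀ t → 3 * t * (3 * t) ≡ 3 * 3 * 3 + (9 * (t * t) - 7) * 3 * 3 + (12 - 72 * (t * t)) * 3 + 144 * (t * t)
    identity t = solve (t ∷ []) ℚ-ring

  ¬Divisible-<5 : ∀ {k} → 0 ℕ.< k → k ℕ.< 5 → ¬ Divisible (+ k)
  ¬Divisible-<5 {k} 0<k k<5 = ¬Divisible-small (+ k) 0<k (ℕP.<-≤-trans k<5 5≤p)

  -- Odd multiples j P₁ reduce modulo p to T = (3, 0), with y/π ≡ 3 j; even multiples reduce to O,
  -- with U ≡ j V for the scaled coordinates U = x π², V = y π³.
  record NearT (j : ℕ) (x y : ℚ) : Set where
    field
      X E        : ℚ
      X-integral : Integral X
      E-integral : Integral E
      x≡         : x ≡ 3 + π * π * X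
      y≡         : y ≡ π * (3 * ι (+ j) + π * E)

  record NearO (j : ℕ) (x y : ℚ) : Set where
    field
      U V E      : ℚ
      U-unit     : Unit U
      V-integral : Integral V
      E-integral : Integral E
      x*π²≡U     : x * (π * π) ≡ U
      y*π³≡V     : y * (π * π * π) ≡ V
      U≡jV       : U ≡ ι (+ j) * V + π * E

  record Specialised (Near : ℕ → ℚ → ℚ → Set) (j : ℕ) (R : Point) : Set where
    field
      x y      : ℚ
      R↦       : R ↦ₚ (x , y)
      on-curve : IsOnCurve x y
      near     : Near j x y

  ¬Specialised-O : ∀ {Near j} → ¬ Specialised Near j O
  ¬Specialised-O record { R↦ = () }

  P₁-near-T : Specialised NearT 1 P₁
  P₁-near-T = record
    { R↦ = P₁↦ ; on-curve = P-on-curve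
    ; near = record
      { X-integral = Integral-lit 0 ; E-integral = Integral-lit 0
      ; x≡ = identity-x π
      ; y≡ = trans (identity-y π) (cong (λ t → π * (3 * t + π * 0ℚ)) (sym (ι-lit 1))) } }
    where
    identity-x : ∀ t → 3 ≡ 3 + t * t * 0ℚ
    identity-x t = solve (t ∷ []) ℚ-ring
    identity-y : ∀ t → 3 * t ≡ t * (3 * 1ℚ + t * 0ℚ)
    identity-y t = solve (t ∷ []) ℚ-ring

  module Doubling (ℓ : ℚ) (slope : ℓ * (2 * (3 * π)) ≡ 3 * (3 * 3) + 2 * A * 3 + B) where
    x₂ y₂ M U V : ℚ
    x₂ = chord-x A ℓ 3 3
    y₂ = chord-y A ℓ 3 (3 * π) 3
    M  = ℓ * π
    U  = x₂ * (π * π)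
    V  = y₂ * (π * π * π)

    open ≡-Reasoning

    M≡ : M ≡ - (+ 1 ℚ./ 2) - 3 * (π * π)
    M≡ = begin
      ℓ * π                                      ≡⟨ identity₁ ℓ π ⟩
      (+ 1 ℚ./ 6) * (ℓ * (2 * (3 * π)))          ≡⟨ cong ((+ 1 ℚ./ 6) *_) slope ⟩
      (+ 1 ℚ./ 6) * (3 * (3 * 3) + 2 * A * 3 + B) ≡⟨ identity₂ π ⟩
      - (+ 1 ℚ./ 2) - 3 * (π * π)                ∎
      where
      identity₁ : ∀ l t → l * t ≡ (+ 1 ℚ./ 6) * (l * (2 * (3 * t)))
      identity₁ l t = solve (l ∷ t ∷ []) ℚ-ring
      identity₂ : ∀ t → (+ 1 ℚ./ 6) * (3 * (3 * 3) + 2 * (9 * (t * t) - 7) * 3 + (12 - 72 * (t * t)))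
                      ≡ - (+ 1 ℚ./ 2) - 3 * (t * t)
      identity₂ t = solve (t ∷ []) ℚ-ring

    U≡ : U ≡ (+ 1 ℚ./ 4) + 4 * (π * π)
    U≡ = begin
      (((ℓ * ℓ - A) - 3) - 3) * (π * π)        ≡⟨ identity₁ ℓ π ⟩
      M * M - π * π * (A + 6)                  ≡⟨ cong (λ t → t * t - π * π * (A + 6)) M≡ ⟩
      (- (+ 1 ℚ./ 2) - 3 * (π * π)) * (- (+ 1 ℚ./ 2) - 3 * (π * π)) - π * π * (A + 6)
                                               ≡⟨ identity₂ π ⟩
      (+ 1 ℚ./ 4) + 4 * (π * π)                ∎
      where
      identity₁ : ∀ l t → (((l * l - (9 * (t * t) - 7)) - 3) - 3) * (t * t)
                        ≡ (l * t) * (l * t) - t * t * ((9 * (t * t) - 7) + 6)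
      identity₁ l t = solve (l ∷ t ∷ []) ℚ-ring
      identity₂ : ∀ t → (- (+ 1 ℚ./ 2) - 3 * (t * t)) * (- (+ 1 ℚ./ 2) - 3 * (t * t)) - t * t * ((9 * (t * t) - 7) + 6)
                      ≡ (+ 1 ℚ./ 4) + 4 * (t * t)
      identity₂ t = solve (t ∷ []) ℚ-ring

    V≡ : V ≡ (+ 1 ℚ./ 8) + (+ 5 ℚ./ 4) * (π * π)
    V≡ = begin
      (ℓ * (3 - x₂) - 3 * π) * (π * π * π)    ≡⟨ identity₁ ℓ x₂ π ⟩
      M * (3 * (π * π) - U) - 3 * (π * π * π * π)
                                               ≡⟨ cong₂ (λ s t → s * (3 * (π * π) - t) - 3 * (π * π * π * π)) M≡ U≡ ⟩
      (- (+ 1 ℚ./ 2) - 3 * (π * π)) * (3 * (π * π) - ((+ 1 ℚ./ 4) + 4 * (π * π))) - 3 * (π * π * π * π)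
                                               ≡⟨ identity₂ π ⟩
      (+ 1 ℚ./ 8) + (+ 5 ℚ./ 4) * (π * π)     ∎
      where
      identity₁ : ∀ l x t → (l * (3 - x) - 3 * t) * (t * t * t) ≡ (l * t) * (3 * (t * t) - x * (t * t)) - 3 * (t * t * t * t)
      identity₁ l x t = solve (l ∷ x ∷ t ∷ []) ℚ-ring
      identity₂ : ∀ t → (- (+ 1 ℚ./ 2) - 3 * (t * t)) * (3 * (t * t) - ((+ 1 ℚ./ 4) + 4 * (t * t))) - 3 * (t * t * t * t)
                      ≡ (+ 1 ℚ./ 8) + (+ 5 ℚ./ 4) * (t * t)
      identity₂ t = solve (t ∷ []) ℚ-ring

    near-O : NearO 2 x₂ y₂
    near-O = record
      { U-unit     = subst Unit (trans (identity₁ π) (sym U≡))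
                       (Unit-+-InIdeal (Unit-ratio 1 4 ¬Divisible-1 (¬Divisible-<5 ℕ.z<s ℕP.≤-refl) refl)
                                       (InIdeal-π* (Integral-* (Integral-lit 4) Integral-π)))
      ; V-integral = subst Integral (sym V≡)
                       (Integral-+ (Integral-ratio 1 8 p∤8 refl)
                                   (Integral-* (Integral-ratio 5 4 p∤4 refl) (Integral-* Integral-π Integral-π)))
      ; E-integral = Integral-* (Integral-ratio 3 2 p∤2 refl) Integral-π
      ; x*π²≡U     = refl
      ; y*π³≡V     = refl
      ; U≡jV       = trans U≡ (trans (identity₂ π)
                       (cong₂ (λ t v → t * v + π * ((+ 3 ℚ./ 2) * π)) (sym (ι-lit 2)) (sym V≡))) }
      where
      p∤2 = ¬Divisible-<5 {2} ℕ.z<s (ℕ.s<s (ℕ.s<s ℕ.z<s))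
      p∤4 = ¬Divisible-<5 {4} ℕ.z<s ℕP.≤-refl
      p∤8 = ¬Divisible-* {+ 2} {+ 4} p∤2 p∤4
      identity₁ : ∀ t → (+ 1 ℚ./ 4) + t * (4 * t) ≡ (+ 1 ℚ./ 4) + 4 * (t * t)
      identity₁ t = solve (t ∷ []) ℚ-ring
      identity₂ : ∀ t → (+ 1 ℚ./ 4) + 4 * (t * t) ≡ 2 * ((+ 1 ℚ./ 8) + (+ 5 ℚ./ 4) * (t * t)) + t * ((+ 3 ℚ./ 2) * t)
      identity₂ t = solve (t ∷ []) ℚ-ring

  2P₁-near-O : Specialised NearO 2 (smul coefA coefB coefC 2 P₁)
  2P₁-near-O = record
    { R↦ = proj₂ (proj₂ tangent) ; on-curve = tangent-on-curve {3} {3 * π} {proj₁ tangent} P-on-curve slope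
    ; near = Doubling.near-O (proj₁ tangent) slope }
    where
    open Curve ℚmn using (eqK; sq; _-K_)
    x-equal : eqK (sq n -K oneR) (sq n -K oneR) ≡ true
    x-equal = refl
    2y-nonzero : DField.isZeroR ℚmn (addR (mulR m (addR oneR n)) (mulR m (addR oneR n))) ≡ false
    2y-nonzero = refl
    tangent = tangent-↦ {coefA} {coefB} {coefC} x-equal 2y-nonzero A↦ B↦ (proj₁ P₁↦) (proj₂ P₁↦)
                        (*-≢0 {2} (λ ()) (*-≢0 {3} (λ ()) π≢0))
    slope : proj₁ tangent * (2 * (3 * π)) ≡ 3 * (3 * 3) + 2 * A * 3 + B
    slope = proj₁ (proj₂ tangent)

  chord-through-P₁ : ∀ {R x y} → R ↦ₚ (x , y) → IsOnCurve x y → x - 3 ≢ 0ℚ →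
                     Σ ℚ λ ℓ → ℓ * (x - 3) ≡ y - 3 * π
                             × add coefA coefB coefC P₁ R ↦ₚ (chord-x A ℓ 3 x , chord-y A ℓ 3 (3 * π) x)
                             × IsOnCurve (chord-x A ℓ 3 x) (chord-y A ℓ 3 (3 * π) x)
  chord-through-P₁ {aff u v} {x} {y} (u↦ , v↦) on x-3≢0 =
    proj₁ chord , proj₁ (proj₂ chord) , proj₂ (proj₂ chord) ,
    chord-on-curve {3} {3 * π} {x} {y} {proj₁ chord} P-on-curve on x-3≢0 (proj₁ (proj₂ chord))
    where
    chord = chord-↦ {coefA} {coefB} {coefC} A↦ (proj₁ P₁↦) (proj₂ P₁↦) u↦ v↦ x-3≢0

  add-P₁ : ∀ {Near Near′ : ℕ → ℚ → ℚ → Set} {j j′ R} →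
           (∀ {x y} → Near j x y → IsOnCurve x y → x - 3 ≢ 0ℚ) →
           (∀ {x y ℓ} → Near j x y → IsOnCurve x y → ℓ * (x - 3) ≡ y - 3 * π →
                        Near′ j′ (chord-x A ℓ 3 x) (chord-y A ℓ 3 (3 * π) x)) →
           Specialised Near j R → Specialised Near′ j′ (add coefA coefB coefC P₁ R)
  add-P₁ {R = R} x≢3 next record { x = x ; y = y ; R↦ = R↦ ; on-curve = on ; near = near } = record
    { R↦ = proj₁ (proj₂ (proj₂ chord)) ; on-curve = proj₂ (proj₂ (proj₂ chord))
    ; near = next {x} {y} {proj₁ chord} near on (proj₁ (proj₂ chord)) }
    where
    chord = chord-through-P₁ {R} {x} {y} R↦ on (x≢3 near on)

  chord-x-offset : ∀ {x y ℓ} → IsOnCurve x y → ℓ * (x - 3) ≡ y - 3 * π →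
    (chord-x A ℓ 3 x - 3) * ((x - 3) * (x - 3)) ≡ (B + 6 * A + 27) * x + (C - 9 * A - 54) - 6 * π * y + 9 * π * π
  chord-x-offset {x} {y} {ℓ} on slope = x-y≡0⇒x≡y (begin
    (chord-x A ℓ 3 x - 3) * ((x - 3) * (x - 3)) - ((B + 6 * A + 27) * x + (C - 9 * A - 54) - 6 * π * y + 9 * π * π)
      ≡⟨ identity A B C ℓ x y π ⟩
    (ℓ * (x - 3) - (y - 3 * π)) * (ℓ * (x - 3) + (y - 3 * π)) + (y * y - (x * x * x + A * x * x + B * x + C))
      ≡⟨ cong₂ (λ s t → s * (ℓ * (x - 3) + (y - 3 * π)) + t) (x≡y⇒x-y≡0 slope) (x≡y⇒x-y≡0 on) ⟩
    0ℚ * (ℓ * (x - 3) + (y - 3 * π)) + 0ℚ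
      ≡⟨ trans (ℚP.+-identityʳ _) (ℚP.*-zeroˡ (ℓ * (x - 3) + (y - 3 * π))) ⟩
    0ℚ ∎)
    where
    open ≡-Reasoning
    identity : ∀ a b c l x y t →
      ((((l * l - a) - 3) - x) - 3) * ((x - 3) * (x - 3)) - ((b + 6 * a + 27) * x + (c - 9 * a - 54) - 6 * t * y + 9 * t * t)
      ≡ (l * (x - 3) - (y - 3 * t)) * (l * (x - 3) + (y - 3 * t)) + (y * y - (x * x * x + a * x * x + b * x + c))
    identity a b c l x y t = solve (a ∷ b ∷ c ∷ l ∷ x ∷ y ∷ t ∷ []) ℚ-ring

  Integral-A : Integral A
  Integral-A = Integral-- (Integral-* (Integral-lit 9) (Integral-* Integral-π Integral-π)) (Integral-lit 7)

  Integral-B : Integral B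
  Integral-B = Integral-- (Integral-lit 12) (Integral-* (Integral-lit 72) (Integral-* Integral-π Integral-π))

  Integral-C : Integral C
  Integral-C = Integral-* (Integral-lit 144) (Integral-* Integral-π Integral-π)

  3π²-InIdeal : InIdeal (3 * (π * π))
  3π²-InIdeal = subst InIdeal (identity π) (InIdeal-π* (Integral-* (Integral-lit 3) Integral-π))
    where
    identity : ∀ t → t * (3 * t) ≡ 3 * (t * t)
    identity t = solve (t ∷ []) ℚ-ring

  NearO⇒x≢3 : ∀ {j x y} → NearO j x y → x - 3 ≢ 0ℚ
  NearO⇒x≢3 {x = x} record { U-unit = U-unit ; x*π²≡U = refl } x-3≡0 =
    Unit≢0 (Unit-+-InIdeal U-unit (InIdeal-neg 3π²-InIdeal)) (begin
      x * (π * π) - 3 * (π * π) ≡⟨ identity x π ⟩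
      (x - 3) * (π * π)         ≡⟨ cong (_* (π * π)) x-3≡0 ⟩
      0ℚ * (π * π)              ≡⟨ ℚP.*-zeroˡ (π * π) ⟩
      0ℚ                        ∎)
    where
    open ≡-Reasoning
    identity : ∀ x t → x * (t * t) - 3 * (t * t) ≡ (x - 3) * (t * t)
    identity x t = solve (x ∷ t ∷ []) ℚ-ring

  -- Modulo p we have V² ≡ U³ and U ≡ j V, and the chord slope is π⁻¹ V/U to leading order; expanding
  -- x₃ and y₃ in π then gives y₃/π ≡ 3 (j + 1).
  module NearO⇒NearT {j x y ℓ} (near : NearO j x y) (on : IsOnCurve x y) (slope : ℓ * (x - 3) ≡ y - 3 * π) where
    open NearO near
    open ≡-Reasoning

    x₃ y₃ : ℚ
    x₃ = chord-x A ℓ 3 x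
    y₃ = chord-y A ℓ 3 (3 * π) x

    U-integral : Integral U
    U-integral = Unit⇒Integral U-unit

    D : ℚ
    D = U - 3 * (π * π)

    D-unit : Unit D
    D-unit = Unit-+-InIdeal U-unit (InIdeal-neg 3π²-InIdeal)

    open Inverse (Unit-inverse D-unit) renaming (a⁻¹ to D⁻¹; a⁻¹-unit to D⁻¹-unit; a⁻¹*a≡1 to D⁻¹*D≡1)
    open Inverse (Unit-inverse U-unit) renaming (a⁻¹ to U⁻¹; a⁻¹-unit to U⁻¹-unit; a⁻¹*a≡1 to U⁻¹*U≡1)

    D⁻¹-integral = Unit⇒Integral D⁻¹-unit
    U⁻¹-integral = Unit⇒Integral U⁻¹-unit

    3π⁴ : ℚ
    3π⁴ = 3 * (π * π * π * π)

    3π⁴-integral : Integral 3π⁴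
    3π⁴-integral = Integral-* (Integral-lit 3) (Integral-* (Integral-* (Integral-* Integral-π Integral-π) Integral-π) Integral-π)

    M : ℚ
    M = ℓ * π

    M*D≡ : M * D ≡ V - 3π⁴
    M*D≡ = begin
      ℓ * π * (U - 3 * (π * π))                   ≡⟨ cong (λ u → ℓ * π * (u - 3 * (π * π))) x*π²≡U ⟨
      ℓ * π * (x * (π * π) - 3 * (π * π))         ≡⟨ identity₁ ℓ x π ⟩
      π * π * π * (ℓ * (x - 3))                   ≡⟨ cong (π * π * π *_) slope ⟩
      π * π * π * (y - 3 * π)                     ≡⟨ identity₂ y π ⟩
      y * (π * π * π) - 3π⁴                       ≡⟨ cong (_- 3π⁴) y*π³≡V ⟩
      V - 3π⁴                                     ∎
      where
      identity₁ : ∀ l x t → l * t * (x * (t * t) - 3 * (t * t)) ≡ t * t * t * (l * (x - 3))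
      identity₁ l x t = solve (l ∷ x ∷ t ∷ []) ℚ-ring
      identity₂ : ∀ y t → t * t * t * (y - 3 * t) ≡ y * (t * t * t) - 3 * (t * t * t * t)
      identity₂ y t = solve (y ∷ t ∷ []) ℚ-ring

    M≡ : M ≡ (V - 3π⁴) * D⁻¹
    M≡ = begin
      M                ≡⟨ ℚP.*-identityʳ M ⟨
      M * 1ℚ           ≡⟨ cong (M *_) D⁻¹*D≡1 ⟨
      M * (D⁻¹ * D)    ≡⟨ rearrange M D⁻¹ D ⟩
      (M * D) * D⁻¹    ≡⟨ cong (_* D⁻¹) M*D≡ ⟩
      (V - 3π⁴) * D⁻¹  ∎
      where
      rearrange : ∀ a b c → a * (b * c) ≡ (a * c) * b
      rearrange a b c = solve (a ∷ b ∷ c ∷ []) ℚ-ring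

    M-integral : Integral M
    M-integral = subst Integral (sym M≡) (Integral-* (Integral-- V-integral 3π⁴-integral) D⁻¹-integral)

    N : ℚ
    N = (B + 6 * A + 27) * U + (C - 9 * A - 54) * (π * π) - 6 * V + 9 * (π * π * π * π)

    N-integral : Integral N
    N-integral =
      Integral-+ (Integral-- (Integral-+ (Integral-* (Integral-+ (Integral-+ Integral-B (Integral-* (Integral-lit 6) Integral-A))
                                                                 (Integral-lit 27)) U-integral)
                                         (Integral-* (Integral-- (Integral-- Integral-C (Integral-* (Integral-lit 9) Integral-A))
                                                                 (Integral-lit 54)) (Integral-* Integral-π Integral-π)))
                             (Integral-* (Integral-lit 6) V-integral))
                 (Integral-* (Integral-lit 9) (Integral-* (Integral-* (Integral-* Integral-π Integral-π) Integral-π) Integral-π))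

    x₃-3*D²≡ : (x₃ - 3) * (D * D) ≡ (π * π) * N
    x₃-3*D²≡ = begin
      (x₃ - 3) * (D * D)
        ≡⟨ cong (λ u → (x₃ - 3) * ((u - 3 * (π * π)) * (u - 3 * (π * π)))) x*π²≡U ⟨
      (x₃ - 3) * ((x * (π * π) - 3 * (π * π)) * (x * (π * π) - 3 * (π * π)))
        ≡⟨ identity₁ (x₃ - 3) x π ⟩
      (π * π * π * π) * ((x₃ - 3) * ((x - 3) * (x - 3)))
        ≡⟨ cong ((π * π * π * π) *_) (chord-x-offset {x} {y} {ℓ} on slope) ⟩
      (π * π * π * π) * ((B + 6 * A + 27) * x + (C - 9 * A - 54) - 6 * π * y + 9 * π * π)
        ≡⟨ identity₂ (B + 6 * A + 27) (C - 9 * A - 54) x y π ⟩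
      (π * π) * ((B + 6 * A + 27) * (x * (π * π)) + (C - 9 * A - 54) * (π * π) - 6 * (y * (π * π * π)) + 9 * (π * π * π * π))
        ≡⟨ cong₂ (λ u v → (π * π) * ((B + 6 * A + 27) * u + (C - 9 * A - 54) * (π * π) - 6 * v + 9 * (π * π * π * π))) x*π²≡U y*π³≡V ⟩
      (π * π) * N
        ∎
      where
      identity₁ : ∀ s x t → s * ((x * (t * t) - 3 * (t * t)) * (x * (t * t) - 3 * (t * t))) ≡ (t * t * t * t) * (s * ((x - 3) * (x - 3)))
      identity₁ s x t = solve (s ∷ x ∷ t ∷ []) ℚ-ring
      identity₂ : ∀ a b x y t → (t * t * t * t) * (a * x + b - 6 * t * y + 9 * t * t) ≡
                    (t * t) * (a * (x * (t * t)) + b * (t * t) - 6 * (y * (t * t * t)) + 9 * (t * t * t * t))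
      identity₂ a b x y t = solve (a ∷ b ∷ x ∷ y ∷ t ∷ []) ℚ-ring

    X′ : ℚ
    X′ = D⁻¹ * D⁻¹ * N

    x₃≡ : x₃ ≡ 3 + π * π * X′
    x₃≡ = begin
      x₃                                        ≡⟨ identity₁ x₃ ⟩
      3 + (x₃ - 3) * (1ℚ * 1ℚ)                  ≡⟨ cong (λ u → 3 + (x₃ - 3) * (u * u)) D⁻¹*D≡1 ⟨
      3 + (x₃ - 3) * ((D⁻¹ * D) * (D⁻¹ * D))    ≡⟨ identity₂ (x₃ - 3) D⁻¹ D ⟩
      3 + ((x₃ - 3) * (D * D)) * (D⁻¹ * D⁻¹)    ≡⟨ cong (λ u → 3 + u * (D⁻¹ * D⁻¹)) x₃-3*D²≡ ⟩
      3 + ((π * π) * N) * (D⁻¹ * D⁻¹)           ≡⟨ identity₃ π N D⁻¹ ⟩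
      3 + π * π * X′                            ∎
      where
      identity₁ : ∀ a → a ≡ 3 + (a - 3) * (1ℚ * 1ℚ)
      identity₁ a = solve (a ∷ []) ℚ-ring
      identity₂ : ∀ s a b → 3 + s * ((a * b) * (a * b)) ≡ 3 + (s * (b * b)) * (a * a)
      identity₂ s a b = solve (s ∷ a ∷ b ∷ []) ℚ-ring
      identity₃ : ∀ t n d → 3 + ((t * t) * n) * (d * d) ≡ 3 + t * t * (d * d * n)
      identity₃ t n d = solve (t ∷ n ∷ d ∷ []) ℚ-ring

    Y′ : ℚ
    Y′ = - M * X′ - 3

    y₃≡ : y₃ ≡ π * Y′
    y₃≡ = begin
      ℓ * (3 - x₃) - 3 * π                        ≡⟨ cong (λ u → ℓ * (3 - u) - 3 * π) x₃≡ ⟩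
      ℓ * (3 - (3 + π * π * X′)) - 3 * π          ≡⟨ identity ℓ π X′ ⟩
      π * (- (ℓ * π) * X′ - 3)                    ∎
      where
      identity : ∀ l t X → l * (3 - (3 + t * t * X)) - 3 * t ≡ t * (- (l * t) * X - 3)
      identity l t X = solve (l ∷ t ∷ X ∷ []) ℚ-ring

    D⁻¹≡ₚU⁻¹ : D⁻¹ ≡ₚ U⁻¹
    D⁻¹≡ₚU⁻¹ = ≡ₚ-intro (subst InIdeal (sym D⁻¹-U⁻¹≡)
                 (InIdeal-π* (Integral-* (Integral-* D⁻¹-integral U⁻¹-integral) (Integral-* (Integral-lit 3) Integral-π))))
      where
      D⁻¹-U⁻¹≡ : D⁻¹ - U⁻¹ ≡ π * (D⁻¹ * U⁻¹ * (3 * π))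
      D⁻¹-U⁻¹≡ = begin
        D⁻¹ - U⁻¹                                       ≡⟨ identity₁ D⁻¹ U⁻¹ ⟩
        D⁻¹ * 1ℚ - U⁻¹ * 1ℚ                             ≡⟨ cong₂ (λ s t → D⁻¹ * s - U⁻¹ * t) U⁻¹*U≡1 D⁻¹*D≡1 ⟨
        D⁻¹ * (U⁻¹ * U) - U⁻¹ * (D⁻¹ * (U - 3 * (π * π))) ≡⟨ identity₂ D⁻¹ U⁻¹ U π ⟩
        π * (D⁻¹ * U⁻¹ * (3 * π))                       ∎
        where
        identity₁ : ∀ a b → a - b ≡ a * 1ℚ - b * 1ℚ
        identity₁ a b = solve (a ∷ b ∷ []) ℚ-ring
        identity₂ : ∀ d w u t → d * (w * u) - w * (d * (u - 3 * (t * t))) ≡ t * (d * w * (3 * t))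
        identity₂ d w u t = solve (d ∷ w ∷ u ∷ t ∷ []) ℚ-ring

    M≡ₚVU⁻¹ : M ≡ₚ V * U⁻¹
    M≡ₚVU⁻¹ = ≡ₚ-trans (≡⇒≡ₚ M≡) (≡ₚ-* (Integral-- V-integral 3π⁴-integral) U⁻¹-integral V-3π⁴≡ₚV D⁻¹≡ₚU⁻¹)
      where
      V-3π⁴≡ₚV : V - 3π⁴ ≡ₚ V
      V-3π⁴≡ₚV = ≡ₚ-intro (subst InIdeal (identity V π)
                   (InIdeal-π* (Integral-neg (Integral-* (Integral-lit 3) (Integral-* (Integral-* Integral-π Integral-π) Integral-π)))))
        where
        identity : ∀ v t → t * (- (3 * (t * t * t))) ≡ (v - 3 * (t * t * t * t)) - v
        identity v t = solve (v ∷ t ∷ []) ℚ-ring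

    T : ℚ
    T = - (3 * U) - 6 * V

    T-integral : Integral T
    T-integral = Integral-- (Integral-neg (Integral-* (Integral-lit 3) U-integral)) (Integral-* (Integral-lit 6) V-integral)

    N≡ₚT : N ≡ₚ T
    N≡ₚT = ≡ₚ-intro (subst InIdeal (sym (identity U V π))
             (InIdeal-π* (Integral-* Integral-π
               (Integral-+ (Integral-+ (Integral-neg (Integral-* (Integral-lit 18) U-integral))
                                       (Integral-* (Integral-lit 72) (Integral-* Integral-π Integral-π)))
                           (Integral-lit 9)))))
      where
      identity : ∀ u v t →
        ((12 - 72 * (t * t)) + 6 * (9 * (t * t) - 7) + 27) * u + (144 * (t * t) - 9 * (9 * (t * t) - 7) - 54) * (t * t)
          - 6 * v + 9 * (t * t * t * t) - (- (3 * u) - 6 * v)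
        ≡ t * (t * (- (18 * u) + 72 * (t * t) + 9))
      identity u v t = solve (u ∷ v ∷ t ∷ []) ℚ-ring

    V²≡ₚU³ : V * V ≡ₚ U * U * U
    V²≡ₚU³ = ≡ₚ-intro (subst InIdeal (sym V²-U³≡)
               (InIdeal-π* (Integral-* Integral-π
                 (Integral-+ (Integral-+ (Integral-* (Integral-* Integral-A U-integral) U-integral)
                                         (Integral-* (Integral-* Integral-B (Integral-* Integral-π Integral-π)) U-integral))
                             (Integral-* Integral-C (Integral-* (Integral-* (Integral-* Integral-π Integral-π) Integral-π) Integral-π))))))
      where
      V²-U³≡ : V * V - U * U * U ≡ π * (π * (A * U * U + B * (π * π) * U + C * (π * π * π * π)))
      V²-U³≡ = begin
        V * V - U * U * U
          ≡⟨ cong₂ (λ s t → s * s - t * t * t) y*π³≡V x*π²≡U ⟨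
        y * (π * π * π) * (y * (π * π * π)) - x * (π * π) * (x * (π * π)) * (x * (π * π))
          ≡⟨ identity₁ x y π ⟩
        (π * π * π * π * π * π) * (y * y) - x * (π * π) * (x * (π * π)) * (x * (π * π))
          ≡⟨ cong (λ t → (π * π * π * π * π * π) * t - x * (π * π) * (x * (π * π)) * (x * (π * π))) on ⟩
        (π * π * π * π * π * π) * (x * x * x + A * x * x + B * x + C) - x * (π * π) * (x * (π * π)) * (x * (π * π))
          ≡⟨ identity₂ x π A B C ⟩
        π * (π * (A * (x * (π * π)) * (x * (π * π)) + B * (π * π) * (x * (π * π)) + C * (π * π * π * π)))
          ≡⟨ cong (λ u → π * (π * (A * u * u + B * (π * π) * u + C * (π * π * π * π)))) x*π²≡U ⟩
        π * (π * (A * U * U + B * (π * π) * U + C * (π * π * π * π)))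
          ∎
        where
        identity₁ : ∀ x y t → y * (t * t * t) * (y * (t * t * t)) - x * (t * t) * (x * (t * t)) * (x * (t * t))
                            ≡ (t * t * t * t * t * t) * (y * y) - x * (t * t) * (x * (t * t)) * (x * (t * t))
        identity₁ x y t = solve (x ∷ y ∷ t ∷ []) ℚ-ring
        identity₂ : ∀ x t a b c → (t * t * t * t * t * t) * (x * x * x + a * x * x + b * x + c) - x * (t * t) * (x * (t * t)) * (x * (t * t))
                                ≡ t * (t * (a * (x * (t * t)) * (x * (t * t)) + b * (t * t) * (x * (t * t)) + c * (t * t * t * t)))
        identity₂ x t a b c = solve (x ∷ t ∷ a ∷ b ∷ c ∷ []) ℚ-ring

    V²U⁻³≡ₚ1 : V * V * (U⁻¹ * U⁻¹ * U⁻¹) ≡ₚ 1ℚ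
    V²U⁻³≡ₚ1 = ≡ₚ-trans (≡ₚ-* (Integral-* V-integral V-integral) (Integral-* (Integral-* U⁻¹-integral U⁻¹-integral) U⁻¹-integral)
                                V²≡ₚU³ (≡⇒≡ₚ refl))
                         (≡⇒≡ₚ (begin
                           U * U * U * (U⁻¹ * U⁻¹ * U⁻¹)            ≡⟨ identity U U⁻¹ ⟩
                           (U⁻¹ * U) * (U⁻¹ * U) * (U⁻¹ * U)        ≡⟨ cong (λ t → t * t * t) U⁻¹*U≡1 ⟩
                           1ℚ * 1ℚ * 1ℚ                             ≡⟨ ℚP.*-identityˡ _ ⟩
                           1ℚ * 1ℚ                                  ≡⟨ ℚP.*-identityˡ _ ⟩
                           1ℚ                                       ∎))
      where
      identity : ∀ u w → u * u * u * (w * w * w) ≡ (w * u) * (w * u) * (w * u)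
      identity u w = solve (u ∷ w ∷ []) ℚ-ring

    VU⁻²≡ₚj : V * U⁻¹ * U⁻¹ ≡ₚ ι (+ j)
    VU⁻²≡ₚj = ≡ₚ-trans (≡⇒≡ₚ VU⁻²≡)
                (≡ₚ-trans (≡ₚ-+ (≡ₚ-* (Integral-ι (+ j)) (Integral-lit 1) (≡⇒≡ₚ refl) V²U⁻³≡ₚ1)
                                (π*≡ₚ0 (Integral-* E-integral (Integral-* (Integral-* (Integral-* V-integral U⁻¹-integral) U⁻¹-integral) U⁻¹-integral))))
                          (≡⇒≡ₚ (trans (ℚP.+-identityʳ _) (ℚP.*-identityʳ _))))
      where
      VU⁻²≡ : V * U⁻¹ * U⁻¹ ≡ ι (+ j) * (V * V * (U⁻¹ * U⁻¹ * U⁻¹)) + π * (E * (V * U⁻¹ * U⁻¹ * U⁻¹))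
      VU⁻²≡ = begin
        V * U⁻¹ * U⁻¹                            ≡⟨ ℚP.*-identityʳ _ ⟨
        V * U⁻¹ * U⁻¹ * 1ℚ                       ≡⟨ cong (V * U⁻¹ * U⁻¹ *_) U⁻¹*U≡1 ⟨
        V * U⁻¹ * U⁻¹ * (U⁻¹ * U)                ≡⟨ cong (λ u → V * U⁻¹ * U⁻¹ * (U⁻¹ * u)) U≡jV ⟩
        V * U⁻¹ * U⁻¹ * (U⁻¹ * (ι (+ j) * V + π * E))
                                                 ≡⟨ identity V U⁻¹ (ι (+ j)) π E ⟩
        ι (+ j) * (V * V * (U⁻¹ * U⁻¹ * U⁻¹)) + π * (E * (V * U⁻¹ * U⁻¹ * U⁻¹)) ∎
        where
        identity : ∀ v w k t e → v * w * w * (w * (k * v + t * e)) ≡ k * (v * v * (w * w * w)) + t * (e * (v * w * w * w))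
        identity v w k t e = solve (v ∷ w ∷ k ∷ t ∷ e ∷ []) ℚ-ring

    -MX′≡ₚ3j+6 : - M * X′ ≡ₚ 3 * ι (+ j) + 6
    -MX′≡ₚ3j+6 =
      ≡ₚ-trans (≡ₚ-* (Integral-neg M-integral) (Integral-* (Integral-* U⁻¹-integral U⁻¹-integral) T-integral)
                     (≡ₚ-neg M≡ₚVU⁻¹)
                     (≡ₚ-* (Integral-* D⁻¹-integral D⁻¹-integral) T-integral (≡ₚ-* D⁻¹-integral U⁻¹-integral D⁻¹≡ₚU⁻¹ D⁻¹≡ₚU⁻¹) N≡ₚT))
      (≡ₚ-trans (≡⇒≡ₚ expand)
      (≡ₚ-trans (≡ₚ-+ (≡ₚ-* (Integral-lit 3) (Integral-ι (+ j)) (≡⇒≡ₚ refl) VU⁻²≡ₚj)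
                      (≡ₚ-* (Integral-lit 6) (Integral-lit 1) (≡⇒≡ₚ refl) V²U⁻³≡ₚ1))
                (≡⇒≡ₚ (cong (λ t → 3 * ι (+ j) + t) (ℚP.*-identityʳ 6)))))
      where
      expand : - (V * U⁻¹) * (U⁻¹ * U⁻¹ * T) ≡ 3 * (V * U⁻¹ * U⁻¹) + 6 * (V * V * (U⁻¹ * U⁻¹ * U⁻¹))
      expand = begin
        - (V * U⁻¹) * (U⁻¹ * U⁻¹ * T)
          ≡⟨ identity V U⁻¹ U ⟩
        3 * (V * U⁻¹ * U⁻¹) * (U⁻¹ * U) + 6 * (V * V * (U⁻¹ * U⁻¹ * U⁻¹))
          ≡⟨ cong (λ t → 3 * (V * U⁻¹ * U⁻¹) * t + 6 * (V * V * (U⁻¹ * U⁻¹ * U⁻¹))) U⁻¹*U≡1 ⟩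
        3 * (V * U⁻¹ * U⁻¹) * 1ℚ + 6 * (V * V * (U⁻¹ * U⁻¹ * U⁻¹))
          ≡⟨ cong (λ s → s + 6 * (V * V * (U⁻¹ * U⁻¹ * U⁻¹))) (ℚP.*-identityʳ (3 * (V * U⁻¹ * U⁻¹))) ⟩
        3 * (V * U⁻¹ * U⁻¹) + 6 * (V * V * (U⁻¹ * U⁻¹ * U⁻¹))
          ∎
        where
        identity : ∀ v w u → - (v * w) * (w * w * (- (3 * u) - 6 * v)) ≡ 3 * (v * w * w) * (w * u) + 6 * (v * v * (w * w * w))
        identity v w u = solve (v ∷ w ∷ u ∷ []) ℚ-ring

    Y′-3[j+1]-InIdeal : InIdeal (Y′ - 3 * ι (+ suc j))
    Y′-3[j+1]-InIdeal = ≡ₚ0⇒InIdeal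
      (≡ₚ-trans (≡⇒≡ₚ (rearrange (- M * X′) (ι (+ suc j))))
      (≡ₚ-trans (≡ₚ-+ -MX′≡ₚ3j+6 (≡⇒≡ₚ refl))
                (≡⇒≡ₚ (trans (cong (λ t → (3 * ι (+ j) + 6) + (- 3 - 3 * t)) (ι-suc j)) (identity (ι (+ j)))))))
      where
      rearrange : ∀ a b → (a - 3) - 3 * b ≡ a + (- 3 - 3 * b)
      rearrange a b = solve (a ∷ b ∷ []) ℚ-ring
      identity : ∀ k → (3 * k + 6) + (- 3 - 3 * (k + 1)) ≡ 0ℚ
      identity k = solve (k ∷ []) ℚ-ring

    near-T : NearT (suc j) x₃ y₃
    near-T = record
      { X-integral = Integral-* (Integral-* D⁻¹-integral D⁻¹-integral) N-integral
      ; E-integral = cofactor-integral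
      ; x≡         = x₃≡
      ; y≡         = trans y₃≡ (cong (π *_) (trans (rearrange Y′ (3 * ι (+ suc j)))
                                                    (cong (λ t → 3 * ι (+ suc j) + t) q≡π*cofactor))) }
      where
      open InIdeal Y′-3[j+1]-InIdeal
      rearrange : ∀ a b → a ≡ b + (a - b)
      rearrange a b = solve (a ∷ b ∷ []) ℚ-ring

  -- Writing x = 3 + π² X, y = π Y: the curve equation gives 3 X ≡ 9 − 9 j² and the chord slope
  -- satisfies (π ℓ) X = Y − 3 ≡ 3 j − 3, so for p ∤ j² − 1 both X and π ℓ are units.
  module NearT⇒NearO {j x y} (3j-3-unit : Unit (3 * ι (+ j) - 3)) (9-9j²-unit : Unit (9 - 9 * ι (+ j) * ι (+ j)))
                     (near : NearT j x y) (on : IsOnCurve x y) where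
    open NearT near
    open ≡-Reasoning

    Y : ℚ
    Y = 3 * ι (+ j) + π * E

    K : ℚ
    K = Y * Y - 9 + (3 + 18 * (π * π)) * X - (2 + 9 * (π * π)) * (π * π) * X * X - (π * π * π * π) * X * X * X

    π²K≡0 : π * (π * K) ≡ 0ℚ
    π²K≡0 = begin
      π * (π * K)
        ≡⟨ identity X E (ι (+ j)) π ⟨
      (π * Y) * (π * Y) - ((3 + π * π * X) * (3 + π * π * X) * (3 + π * π * X) + A * (3 + π * π * X) * (3 + π * π * X)
                            + B * (3 + π * π * X) + C)
        ≡⟨ cong₂ (λ s t → s * s - (t * t * t + A * t * t + B * t + C)) y≡ x≡ ⟨
      y * y - (x * x * x + A * x * x + B * x + C)
        ≡⟨ x≡y⇒x-y≡0 on ⟩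
      0ℚ ∎
      where
      identity : ∀ X E k t →
        (t * (3 * k + t * E)) * (t * (3 * k + t * E))
          - ((3 + t * t * X) * (3 + t * t * X) * (3 + t * t * X) + (9 * (t * t) - 7) * (3 + t * t * X) * (3 + t * t * X)
             + (12 - 72 * (t * t)) * (3 + t * t * X) + 144 * (t * t))
        ≡ t * (t * ((3 * k + t * E) * (3 * k + t * E) - 9 + (3 + 18 * (t * t)) * X
                    - (2 + 9 * (t * t)) * (t * t) * X * X - (t * t * t * t) * X * X * X))
      identity X E k t = solve (X ∷ E ∷ k ∷ t ∷ []) ℚ-ring

    G : ℚ
    G = - (6 * ι (+ j) * E + π * E * E) - 18 * π * X + (2 + 9 * (π * π)) * π * X * X + π * π * π * X * X * X

    G-integral : Integral G
    G-integral =
      Integral-+ (Integral-+ (Integral-- (Integral-neg (Integral-+ (Integral-* (Integral-* (Integral-lit 6) (Integral-ι (+ j))) E-integral)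
                                                                   (Integral-* (Integral-* Integral-π E-integral) E-integral)))
                                         (Integral-* (Integral-* (Integral-lit 18) Integral-π) X-integral))
                             (Integral-* (Integral-* (Integral-* (Integral-+ (Integral-lit 2) (Integral-* (Integral-lit 9) (Integral-* Integral-π Integral-π)))
                                                                 Integral-π) X-integral) X-integral))
                 (Integral-* (Integral-* (Integral-* (Integral-* (Integral-* Integral-π Integral-π) Integral-π) X-integral) X-integral) X-integral)

    3X≡ : 3 * X ≡ (9 - 9 * ι (+ j) * ι (+ j)) + π * G
    3X≡ = x-y≡0⇒x≡y (trans (identity X E (ι (+ j)) π) (x*y≡0⇒y≡0 π≢0 (x*y≡0⇒y≡0 π≢0 π²K≡0)))
      where
      identity : ∀ X E k t →
        3 * X - ((9 - 9 * k * k) + t * (- (6 * k * E + t * E * E) - 18 * t * X + (2 + 9 * (t * t)) * t * X * X + t * t * t * X * X * X))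
        ≡ (3 * k + t * E) * (3 * k + t * E) - 9 + (3 + 18 * (t * t)) * X - (2 + 9 * (t * t)) * (t * t) * X * X - (t * t * t * t) * X * X * X
      identity X E k t = solve (X ∷ E ∷ k ∷ t ∷ []) ℚ-ring

    ⅓ : ℚ
    ⅓ = + 1 ℚ./ 3

    ⅓-unit : Unit ⅓
    ⅓-unit = Unit-ratio 1 3 ¬Divisible-1 (¬Divisible-<5 ℕ.z<s (ℕ.s<s (ℕ.s<s (ℕ.s<s ℕ.z<s)))) refl

    X-unit : Unit X
    X-unit = subst Unit (identity X) (Unit-* (subst Unit (sym 3X≡) (Unit-+-InIdeal 9-9j²-unit (InIdeal-π* G-integral))) ⅓-unit)
      where
      identity : ∀ X → 3 * X * ⅓ ≡ X
      identity X = solve (X ∷ []) ℚ-ring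

    open Inverse (Unit-inverse X-unit) renaming (a⁻¹ to X⁻¹; a⁻¹-unit to X⁻¹-unit; a⁻¹*a≡1 to X⁻¹*X≡1)

    x-3≢0 : x - 3 ≢ 0ℚ
    x-3≢0 x-3≡0 = Unit≢0 X-unit (x*y≡0⇒y≡0 π≢0 (x*y≡0⇒y≡0 π≢0 (begin
      π * (π * X)          ≡⟨ identity X π ⟩
      (3 + π * π * X) - 3  ≡⟨ cong (_- 3) x≡ ⟨
      x - 3                ≡⟨ x-3≡0 ⟩
      0ℚ                   ∎)))
      where
      identity : ∀ X t → t * (t * X) ≡ (3 + t * t * X) - 3
      identity X t = solve (X ∷ t ∷ []) ℚ-ring

    module _ {ℓ} (slope : ℓ * (x - 3) ≡ y - 3 * π) where
      L : ℚ
      L = ℓ * π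

      L*X≡ : L * X ≡ Y - 3
      L*X≡ = *-cancelˡ-≢0 π≢0 (begin
        π * (ℓ * π * X)              ≡⟨ identity₁ ℓ X π ⟩
        ℓ * ((3 + π * π * X) - 3)    ≡⟨ cong (λ t → ℓ * (t - 3)) x≡ ⟨
        ℓ * (x - 3)                  ≡⟨ slope ⟩
        y - 3 * π                    ≡⟨ cong (_- 3 * π) y≡ ⟩
        π * Y - 3 * π                ≡⟨ identity₂ Y π ⟩
        π * (Y - 3)                  ∎)
        where
        identity₁ : ∀ l X t → t * (l * t * X) ≡ l * ((3 + t * t * X) - 3)
        identity₁ l X t = solve (l ∷ X ∷ t ∷ []) ℚ-ring
        identity₂ : ∀ Y t → t * Y - 3 * t ≡ t * (Y - 3)
        identity₂ Y t = solve (Y ∷ t ∷ []) ℚ-ring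

      L≡ : L ≡ (Y - 3) * X⁻¹
      L≡ = begin
        L                ≡⟨ ℚP.*-identityʳ L ⟨
        L * 1ℚ           ≡⟨ cong (L *_) X⁻¹*X≡1 ⟨
        L * (X⁻¹ * X)    ≡⟨ rearrange L X⁻¹ X ⟩
        (L * X) * X⁻¹    ≡⟨ cong (_* X⁻¹) L*X≡ ⟩
        (Y - 3) * X⁻¹    ∎
        where
        rearrange : ∀ a b c → a * (b * c) ≡ (a * c) * b
        rearrange a b c = solve (a ∷ b ∷ c ∷ []) ℚ-ring

      L-unit : Unit L
      L-unit = subst Unit (sym L≡) (Unit-* Y-3-unit X⁻¹-unit)
        where
        Y-3-unit : Unit (Y - 3)
        Y-3-unit = subst Unit (identity (ι (+ j)) π E) (Unit-+-InIdeal 3j-3-unit (InIdeal-π* E-integral))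
          where
          identity : ∀ k t E → (3 * k - 3) + t * E ≡ (3 * k + t * E) - 3
          identity k t E = solve (k ∷ t ∷ E ∷ []) ℚ-ring

      L-integral = Unit⇒Integral L-unit

      x₃ y₃ U₃ V₃ W₃ : ℚ
      x₃ = chord-x A ℓ 3 x
      y₃ = chord-y A ℓ 3 (3 * π) x
      U₃ = x₃ * (π * π)
      V₃ = y₃ * (π * π * π)
      W₃ = π * (A + 6 + π * π * X)

      W₃-integral : Integral W₃
      W₃-integral = Integral-* Integral-π (Integral-+ (Integral-+ Integral-A (Integral-lit 6)) (Integral-* (Integral-* Integral-π Integral-π) X-integral))

      U₃≡ : U₃ ≡ L * L - π * W₃
      U₃≡ = begin
        (((ℓ * ℓ - A) - 3) - x) * (π * π)                ≡⟨ cong (λ t → (((ℓ * ℓ - A) - 3) - t) * (π * π)) x≡ ⟩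
        (((ℓ * ℓ - A) - 3) - (3 + π * π * X)) * (π * π)  ≡⟨ identity ℓ A X π ⟩
        L * L - π * W₃                                   ∎
        where
        identity : ∀ l a X t → (((l * l - a) - 3) - (3 + t * t * X)) * (t * t) ≡ l * t * (l * t) - t * (t * (a + 6 + t * t * X))
        identity l a X t = solve (l ∷ a ∷ X ∷ t ∷ []) ℚ-ring

      V₃≡ : V₃ ≡ L * (3 * (π * π) - U₃) - 3 * (π * π * π * π)
      V₃≡ = identity ℓ x₃ π
        where
        identity : ∀ l x t → (l * (3 - x) - 3 * t) * (t * t * t) ≡ l * t * (3 * (t * t) - x * (t * t)) - 3 * (t * t * t * t)
        identity l x t = solve (l ∷ x ∷ t ∷ []) ℚ-ring

      U₃-unit : Unit U₃
      U₃-unit = subst Unit (sym U₃≡) (Unit-+-InIdeal (Unit-* L-unit L-unit) (InIdeal-neg (InIdeal-π* W₃-integral)))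

      U₃-integral = Unit⇒Integral U₃-unit

      V₃-integral : Integral V₃
      V₃-integral = subst Integral (sym V₃≡)
        (Integral-- (Integral-* L-integral (Integral-- (Integral-* (Integral-lit 3) (Integral-* Integral-π Integral-π)) U₃-integral))
                    (Integral-* (Integral-lit 3) (Integral-* (Integral-* (Integral-* Integral-π Integral-π) Integral-π) Integral-π)))

      k : ℚ
      k = ι (+ j) + 1

      k-integral : Integral k
      k-integral = Integral-+ (Integral-ι (+ j)) (Integral-lit 1)

      U₃≡ₚL² : U₃ ≡ₚ L * L
      U₃≡ₚL² = ≡ₚ-intro (subst InIdeal (rearrange U₃ L (π * W₃) U₃≡) (InIdeal-neg (InIdeal-π* W₃-integral)))
        where
        rearrange : ∀ u l w → u ≡ l * l - w → - w ≡ u - l * l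
        rearrange u l w refl = solve (l ∷ w ∷ []) ℚ-ring

      1+kL≡ : 1ℚ + k * L ≡ π * (X⁻¹ * (⅓ * (G + 3 * k * E)))
      1+kL≡ = begin
        1ℚ + k * L                               ≡⟨ cong₂ (λ s t → s + k * t) (sym X⁻¹*X≡1) L≡ ⟩
        X⁻¹ * X + k * ((Y - 3) * X⁻¹)            ≡⟨ identity₁ X⁻¹ X k Y ⟩
        X⁻¹ * (⅓ * (3 * (X + k * (Y - 3))))      ≡⟨ cong (λ t → X⁻¹ * (⅓ * t)) 3[X+k[Y-3]]≡ ⟩
        X⁻¹ * (⅓ * (π * (G + 3 * k * E)))        ≡⟨ identity₂ X⁻¹ π (G + 3 * k * E) ⟩
        π * (X⁻¹ * (⅓ * (G + 3 * k * E)))        ∎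
        where
        identity₁ : ∀ w X k Y → w * X + k * ((Y - 3) * w) ≡ w * (⅓ * (3 * (X + k * (Y - 3))))
        identity₁ w X k Y = solve (w ∷ X ∷ k ∷ Y ∷ []) ℚ-ring
        identity₂ : ∀ w t g → w * (⅓ * (t * g)) ≡ t * (w * (⅓ * g))
        identity₂ w t g = solve (w ∷ t ∷ g ∷ []) ℚ-ring
        3[X+k[Y-3]]≡ : 3 * (X + k * (Y - 3)) ≡ π * (G + 3 * k * E)
        3[X+k[Y-3]]≡ = begin
          3 * (X + k * (Y - 3))                           ≡⟨ identity₃ X k Y ⟩
          3 * X + 3 * k * (Y - 3)                         ≡⟨ cong (λ t → t + 3 * k * (Y - 3)) 3X≡ ⟩
          (9 - 9 * ι (+ j) * ι (+ j)) + π * G + 3 * (ι (+ j) + 1) * ((3 * ι (+ j) + π * E) - 3)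
                                                          ≡⟨ identity₄ (ι (+ j)) π G E ⟩
          π * (G + 3 * (ι (+ j) + 1) * E)                 ∎
          where
          identity₃ : ∀ X k Y → 3 * (X + k * (Y - 3)) ≡ 3 * X + 3 * k * (Y - 3)
          identity₃ X k Y = solve (X ∷ k ∷ Y ∷ []) ℚ-ring
          identity₄ : ∀ k t G E → (9 - 9 * k * k) + t * G + 3 * (k + 1) * ((3 * k + t * E) - 3) ≡ t * (G + 3 * (k + 1) * E)
          identity₄ k t G E = solve (k ∷ t ∷ G ∷ E ∷ []) ℚ-ring

      U₃-[j+1]V₃-InIdeal : InIdeal (U₃ - ι (+ suc j) * V₃)
      U₃-[j+1]V₃-InIdeal = ≡ₚ0⇒InIdeal
        (≡ₚ-trans (≡⇒≡ₚ (trans (cong (λ t → U₃ - t * V₃) (ι-suc j)) expand))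
        (≡ₚ-trans (≡ₚ-+ (≡ₚ-+ U₃≡ₚL² (≡ₚ-* (Integral-* k-integral L-integral) (Integral-* L-integral L-integral) (≡⇒≡ₚ refl) U₃≡ₚL²))
                        (π*≡ₚ0 (Integral-- (Integral-* (Integral-* k-integral (Integral-lit 3)) (Integral-* (Integral-* Integral-π Integral-π) Integral-π))
                                           (Integral-* (Integral-* k-integral L-integral) (Integral-* (Integral-lit 3) Integral-π)))))
        (≡ₚ-trans (≡⇒≡ₚ (factor L k))
        (≡ₚ-trans (≡ₚ-* (Integral-* L-integral L-integral) (Integral-lit 0) (≡⇒≡ₚ refl)
                        (≡ₚ-trans (≡⇒≡ₚ 1+kL≡)
                                  (π*≡ₚ0 (Integral-* (Unit⇒Integral X⁻¹-unit)
                                           (Integral-* (Unit⇒Integral ⅓-unit) (Integral-+ G-integral (Integral-* (Integral-* (Integral-lit 3) k-integral) E-integral)))))))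
                  (≡⇒≡ₚ (ℚP.*-zeroʳ (L * L)))))))
        where
        expand : U₃ - k * V₃ ≡ (U₃ + k * L * U₃) + π * (k * 3 * (π * π * π) - k * L * (3 * π))
        expand = trans (cong (λ t → U₃ - k * t) V₃≡) (identity U₃ k L π)
          where
          identity : ∀ u k l t → u - k * (l * (3 * (t * t) - u) - 3 * (t * t * t * t)) ≡ (u + k * l * u) + t * (k * 3 * (t * t * t) - k * l * (3 * t))
          identity u k l t = solve (u ∷ k ∷ l ∷ t ∷ []) ℚ-ring
        factor : ∀ l k → (l * l + k * l * (l * l)) + 0ℚ ≡ l * l * (1ℚ + k * l)
        factor l k = solve (l ∷ k ∷ []) ℚ-ring

      near-O : NearO (suc j) x₃ y₃
      near-O = record
        { U-unit     = U₃-unit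
        ; V-integral = V₃-integral
        ; E-integral = cofactor-integral
        ; x*π²≡U     = refl
        ; y*π³≡V     = refl
        ; U≡jV       = trans (rearrange U₃ (ι (+ suc j) * V₃)) (cong (λ t → ι (+ suc j) * V₃ + t) q≡π*cofactor) }
        where
        open InIdeal U₃-[j+1]V₃-InIdeal
        rearrange : ∀ u v → u ≡ v + (u - v)
        rearrange u v = solve (u ∷ v ∷ []) ℚ-ring

  j²-1-units : ∀ k → suc (suc (suc k)) ℕ.< p →
               Unit (3 * ι (+ suc (suc k)) - 3) × Unit (9 - 9 * ι (+ suc (suc k)) * ι (+ suc (suc k)))
  j²-1-units k k+3<p =
    subst Unit (trans (identity₁ a) (cong (λ t → 3 * t - 3) (sym (ι-suc (suc k))))) (Unit-* 3-unit a-unit) ,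
    subst Unit (trans (identity₂ a) (cong (λ t → 9 - 9 * t * t) (sym (ι-suc (suc k))))) (Unit-neg (Unit-* (Unit-* 9-unit a-unit) a+2-unit))
    where
    a : ℚ
    a = ι (+ suc k)
    p∤3 = ¬Divisible-<5 {3} ℕ.z<s (ℕ.s<s (ℕ.s<s (ℕ.s<s ℕ.z<s)))
    3-unit = Unit-ratio 3 1 p∤3 ¬Divisible-1 refl
    9-unit = Unit-ratio 9 1 (¬Divisible-* {+ 3} {+ 3} p∤3 p∤3) ¬Divisible-1 refl
    a-unit : Unit a
    a-unit = Unit-ι (¬Divisible-small (+ suc k) ℕ.z<s
                      (ℕP.<-trans (ℕP.<-trans (ℕP.n<1+n (suc k)) (ℕP.n<1+n (suc (suc k)))) k+3<p))
    a+2-unit : Unit ((a + 1) + 1)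
    a+2-unit = subst Unit (trans (ι-suc (suc (suc k))) (cong (_+ 1) (ι-suc (suc k))))
                          (Unit-ι (¬Divisible-small (+ suc (suc (suc k))) ℕ.z<s k+3<p))
    identity₁ : ∀ a → 3 * a ≡ 3 * (a + 1) - 3
    identity₁ a = solve (a ∷ []) ℚ-ring
    identity₂ : ∀ a → - (9 * a * ((a + 1) + 1)) ≡ 9 - 9 * (a + 1) * (a + 1)
    identity₂ a = solve (a ∷ []) ℚ-ring

  Shape : ℕ → Point → Set
  Shape j R = Specialised NearT j R ⊎ Specialised NearO j R

  multiple-shape : ∀ k → suc (suc k) ℕ.≤ p → Shape (suc k) (smul coefA coefB coefC (suc k) P₁)
  multiple-shape zero          _     = inj₁ P₁-near-T
  multiple-shape (suc zero)    _     = inj₂ 2P₁-near-O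
  multiple-shape (suc (suc k)) k+4≤p with multiple-shape (suc k) (ℕP.<⇒≤ k+4≤p)
  ... | inj₁ near-T = inj₂ (add-P₁ (NearT⇒NearO.x-3≢0 3j-3-unit 9-9j²-unit)
                                   (λ {_} {_} {ℓ} near on → NearT⇒NearO.near-O 3j-3-unit 9-9j²-unit near on {ℓ}) near-T)
    where
    3j-3-unit = proj₁ (j²-1-units k k+4≤p)
    9-9j²-unit = proj₂ (j²-1-units k k+4≤p)
  ... | inj₂ near-O = inj₁ (add-P₁ (λ near _ → NearO⇒x≢3 near) (λ {_} {_} {ℓ} → NearO⇒NearT.near-T {ℓ = ℓ}) near-O)

  multiple≢O : ∀ k → suc (suc k) ℕ.≤ p → smul coefA coefB coefC (suc k) P₁ ≢ O
  multiple≢O k k+2≤p kP₁≡O with subst (Shape (suc k)) kP₁≡O (multiple-shape k k+2≤p)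
  ... | inj₁ near-T = ¬Specialised-O near-T
  ... | inj₂ near-O = ¬Specialised-O near-O

mainTheorem10 : Curve.OnCurve ℚmn coefA coefB coefC P₁
                × (∀ (k : ℕ) → Curve.smul ℚmn coefA coefB coefC (suc k) P₁ ≢ Curve.O)
mainTheorem10 = tt , λ k →
  let (p , p-prime , k+4<p) = larger-prime (4 ℕ.+ k)
  in multiple≢O p p-prime (ℕP.≤-trans (ℕP.m≤m+n 5 k) k+4<p) k (ℕP.≤-trans (ℕP.m≤n+m (2 ℕ.+ k) 3) k+4<p)
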